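{- Let $k\ge5$ be odd, let $u$ and $v$ be vertices of the Isaacs snark $J_k$ at distance at least $3$, and let $M=J_k-(u,v)$ be the resulting $(3,3)$-pole (with any ordering of the semiedges within each connector). Let $a,b,c,d,e\in\mathbb{K}$ satisfy $a+b=c+d+e\ne0$. Then $(a,b_2,b_3,c,d,e)\in\operatorname{Col}(M)$ for some $b_2,b_3\in\mathbb{K}$ with $b_2+b_3=b$.
   Context: For odd $k\ge3$, the Isaacs snark $J_k$ has vertices $a_i,b_i,c_i,d_i$ for $i\in\mathbb{Z}_k$ and edges $a_ib_i$, $a_ic_i$, $a_id_i$, $b_ib_{i+1}$ ($i\in\mathbb{Z}_k$), together with the $2k$-cycle $c_0c_1\cdots c_{k-1}d_0d_1\cdots d_{k-1}c_0$. $J_k-(u,v)$ denotes the $(3,3)$-pole obtained by deleting $u$ and $v$ and turning each of their incident edges into a dangling edge; the three semiedges (free ends) arising from the edges at $u$ form the first connector and the three arising from the edges at $v$ form the second connector. Let $\mathbb{K}=\mathbb{Z}_2\times\mathbb{Z}_2\setminus\{(0,0)\}$. A colouring of a multipole assigns elements of $\mathbb{K}$ to edges so that the three edge ends at each vertex sum to $0$; $\operatorname{Col}(M)$ is the set of tuples of colours of the semiedges (first connector, then second connector, each in its order) over all colourings of $M$. -}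

module Defs where

open import Data.Bool using (Bool; true; false; not; _xor_; if_then_else_)
open import Data.Nat using (ℕ; zero; suc; _+_; _<?_)
open import Data.Fin using (Fin; zero; suc; toℕ; fromℕ<) renaming (_≟_ to _≟ᶠ_)
open import Data.Product using (_×_; _,_; proj₁; proj₂; ∃; ∃-syntax; Σ)
open import Data.Sum using (_⊎_)
open import Data.List using (List; []; _∷_; _++_; concatMap; map; foldr)
open import Data.List.Relation.Binary.Permutation.Propositional using (_↭_)
open import Relation.Binary.PropositionalEquality using (_≡_; _≢_; refl; cong)
open import Relation.Nullary using (¬_; Dec; yes; no; does)

Odd : ℕ → Set
Odd k = ∃[ m ] k ≡ suc (m + m)

Z2² : Set
Z2² = Bool × Bool

0Z : Z2²
0Z = false , false

infixl 6 _⊕_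
_⊕_ : Z2² → Z2² → Z2²
(x , y) ⊕ (x' , y') = (x xor x') , (y xor y')

data 𝕂 : Set where
  κ₁ κ₂ κ₃ : 𝕂

ι : 𝕂 → Z2²
ι κ₁ = false , true
ι κ₂ = true  , false
ι κ₃ = true  , true

isLast : ∀ {k} → Fin k → Bool
isLast {k} i = not (does (suc (toℕ i) <? k))

nxt : ∀ {k} → Fin k → Fin k
nxt {suc n} i with suc (toℕ i) <? suc n
... | yes p = fromℕ< p
... | no _  = zero

data Vtx (k : ℕ) : Set where
  a b c d : Fin k → Vtx k

-- Edges: ab i = a_i b_i, ac i = a_i c_i, ad i = a_i d_i, bb i = b_i b_{i+1},
-- and the 2k-cycle c_0 c_1 ⋯ c_{k-1} d_0 d_1 ⋯ d_{k-1} c_0 split as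
-- cc i = c_i c_{i+1} (i < k-1),  cc (k-1) = c_{k-1} d_0,
-- dd i = d_i d_{i+1} (i < k-1),  dd (k-1) = d_{k-1} c_0.
data Edge (k : ℕ) : Set where
  ab ac ad bb cc dd : Fin k → Edge k

ends : ∀ {k} → Edge k → Vtx k × Vtx k
ends (ab i) = a i , b i
ends (ac i) = a i , c i
ends (ad i) = a i , d i
ends (bb i) = b i , b (nxt i)
ends (cc i) = c i , (if isLast i then d (nxt i) else c (nxt i))
ends (dd i) = d i , (if isLast i then c (nxt i) else d (nxt i))

allFin : ∀ k → List (Fin k)
allFin zero = []
allFin (suc k) = zero ∷ map suc (allFin k)

allEdges : ∀ k → List (Edge k)
allEdges k = concatMap (λ i → ab i ∷ ac i ∷ ad i ∷ bb i ∷ cc i ∷ dd i ∷ []) (allFin k)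

_≟ᵛ_ : ∀ {k} (x y : Vtx k) → Dec (x ≡ y)
a i ≟ᵛ a j with i ≟ᶠ j
... | yes refl = yes refl
... | no ne = no λ { refl → ne refl }
b i ≟ᵛ b j with i ≟ᶠ j
... | yes refl = yes refl
... | no ne = no λ { refl → ne refl }
c i ≟ᵛ c j with i ≟ᶠ j
... | yes refl = yes refl
... | no ne = no λ { refl → ne refl }
d i ≟ᵛ d j with i ≟ᶠ j
... | yes refl = yes refl
... | no ne = no λ { refl → ne refl }
a _ ≟ᵛ b _ = no λ ()
a _ ≟ᵛ c _ = no λ ()
a _ ≟ᵛ d _ = no λ ()
b _ ≟ᵛ a _ = no λ ()
b _ ≟ᵛ c _ = no λ ()
b _ ≟ᵛ d _ = no λ ()
c _ ≟ᵛ a _ = no λ ()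
c _ ≟ᵛ b _ = no λ ()
c _ ≟ᵛ d _ = no λ ()
d _ ≟ᵛ a _ = no λ ()
d _ ≟ᵛ b _ = no λ ()
d _ ≟ᵛ c _ = no λ ()

endsAt : ∀ {k} → Vtx k → List (Edge k)
endsAt {k} w = concatMap at (allEdges k)
  where
  at : Edge k → List (Edge k)
  at e = (if does (proj₁ (ends e) ≟ᵛ w) then e ∷ [] else [])
      ++ (if does (proj₂ (ends e) ≟ᵛ w) then e ∷ [] else [])

Adj : ∀ {k} → Vtx k → Vtx k → Set
Adj x y = ∃[ e ] (ends e ≡ (x , y) ⊎ ends e ≡ (y , x))

Dist≥3 : ∀ {k} → Vtx k → Vtx k → Set
Dist≥3 u v = u ≢ v × ¬ Adj u v × ¬ (∃[ w ] (Adj u w × Adj w v))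

-- Its edges (including the dangling ones) are exactly the edges of J_k
-- (an edge at u or v becomes a dangling edge, with its semiedge = the end
-- that was at u resp. v); its vertices are those of J_k other than u, v.

sumZ : List Z2² → Z2²
sumZ = foldr _⊕_ 0Z

IsColouring-J-minus : ∀ {k} (u v : Vtx k) → (Edge k → 𝕂) → Set
IsColouring-J-minus {k} u v φ =
  ∀ (w : Vtx k) → w ≢ u → w ≢ v → sumZ (map (λ e → ι (φ e)) (endsAt w)) ≡ 0Z

InCol : ∀ {k} (u v : Vtx k) (e₁ e₂ e₃ f₁ f₂ f₃ : Edge k)
        (x₁ x₂ x₃ y₁ y₂ y₃ : 𝕂) → Set
InCol {k} u v e₁ e₂ e₃ f₁ f₂ f₃ x₁ x₂ x₃ y₁ y₂ y₃ =
  Σ (Edge k → 𝕂) λ φ → IsColouring-J-minus u v φ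
    × φ e₁ ≡ x₁ × φ e₂ ≡ x₂ × φ e₃ ≡ x₃
    × φ f₁ ≡ y₁ × φ f₂ ≡ y₂ × φ f₃ ≡ y₃

module Submission where

-- J_k is a ring of k slices {a_i, b_i, c_i, d_i} joined along three rails, the c- and d-rails
-- crossing once.  A colouring is thus a closed sequence of rail states (the colours of the three
-- rail edges between consecutive slices), and an intact slice leads from x to y exactly when x
-- and y differ on every rail and have the same sum.  Whether a run of L intact slices can join
-- two states depends only on whether L is 0, 1, even or odd, so colouring J_k - (u, v) becomes a
-- finite problem about the two broken slices and the two runs between them, of total length
-- k - 2 (odd).  Every permutation of 𝕂 is additive, so we may assume α = κ₁ and α + β = κ₃; an
-- exhaustive search then solves every configuration in which u and v are at distance ≥ 3.

open import Defs
open import Data.Bool using (Bool; true; false; not; _∧_; _∨_; _xor_; if_then_else_; T)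
open import Data.Bool.Properties using (xor-comm; xor-assoc; xor-identityʳ; xor-same; T-∧; T-∨; T?; if-float)
  renaming (_≟_ to _≟ᵇ_)
open import Data.Bool.ListAction using (all)
open import Data.Empty using (⊥-elim)
open import Data.Fin using (Fin; zero; suc; toℕ; fromℕ; inject₁) renaming (_≟_ to _≟ᶠ_)
import Data.Fin.Properties as Fin
open import Data.Fin.Properties using (toℕ<n; toℕ-fromℕ<; toℕ-fromℕ; toℕ-inject₁; toℕ-injective)
open import Data.List.Base
  using (List; []; _∷_; _++_; map; concatMap; length; take; drop; cartesianProduct; findᵇ; filterᵇ)
open import Data.List.Properties
  using (concatMap-++; concatMap-map; ++-assoc; ++-identityʳ; map-∘; length-map; length-++;
         length-take; length-drop; take++drop≡id)
open import Data.List.Membership.Propositional using (_∈_)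
open import Data.List.Relation.Unary.All using (All; []; _∷_)
import Data.List.Relation.Unary.All as All
open import Data.List.Relation.Unary.All.Properties using (all⁺)
import Data.List.Relation.Unary.All.Properties as Allₚ
open import Data.List.Relation.Unary.Any using (here; there; any?)
open import Data.List.Relation.Binary.Permutation.Propositional as ↭
  using (_↭_; prep; swap; ↭-refl; ↭-trans; ↭-reflexive; module PermutationReasoning)
open import Data.List.Relation.Binary.Permutation.Propositional.Properties
  using (++⁺; ++⁺ˡ; shifts; map⁺; ∈-resp-↭)
open import Data.Maybe using (Maybe; just; nothing; fromMaybe; maybe′)
import Data.Maybe.Properties as Maybe
open import Data.Nat using (ℕ; zero; suc; _+_; _∸_; _⊓_; _<_; _≮_; _≤_; _<?_; s≤s)
open import Data.Nat.Properties
  using (≤-pred; ≤-antisym; ≮⇒≥; <⇒≢; ≤⇒≯; n≮n; n≤1+n; 1+n≢n; suc-injective; +-identityʳ; +-suc;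
         +-assoc; +-comm; m≤m+n; m≤n⇒m⊓n≡m; m+n∸m≡n; m+n≡0⇒m≡0; m+n≡0⇒n≡0;
         m≤n⇒∃[o]m+o≡n; <-cmp)
open import Data.Product using (_×_; _,_; proj₁; proj₂; ∃-syntax)
import Data.Product.Properties as Product
open import Data.Sum using (_⊎_; inj₁; inj₂)
open import Data.Unit using (tt)
open import Function using (_∘_; id; flip)
open import Function.Bundles using (Equivalence)
open import Relation.Binary.Definitions using (DecidableEquality; tri<; tri≈; tri>)
open import Relation.Binary.PropositionalEquality
open import Relation.Nullary using (Dec; yes; no; ¬_; does; contradiction)
open import Relation.Nullary.Decidable
  using (⌊_⌋; toWitness; fromWitness; fromWitnessFalse; map′; _×-dec_; _⊎-dec_; dec-true; dec-false)

⊕-comm : (x y : Z2²) → x ⊕ y ≡ y ⊕ x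
⊕-comm (p , q) (p′ , q′) = cong₂ _,_ (xor-comm p p′) (xor-comm q q′)

⊕-assoc : (x y z : Z2²) → x ⊕ y ⊕ z ≡ x ⊕ (y ⊕ z)
⊕-assoc (p , q) (p′ , q′) (p″ , q″) = cong₂ _,_ (xor-assoc p p′ p″) (xor-assoc q q′ q″)

⊕-identityʳ : (x : Z2²) → x ⊕ 0Z ≡ x
⊕-identityʳ (p , q) = cong₂ _,_ (xor-identityʳ p) (xor-identityʳ q)

⊕-self : (x : Z2²) → x ⊕ x ≡ 0Z
⊕-self (p , q) = cong₂ _,_ (xor-same p) (xor-same q)

⊕-cancelˡ : (x : Z2²) {y z : Z2²} → x ⊕ y ≡ x ⊕ z → y ≡ z
⊕-cancelˡ x {y} {z} eq = begin
  y            ≡⟨ cong (_⊕ y) (⊕-self x) ⟨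
  x ⊕ x ⊕ y    ≡⟨ ⊕-assoc x x y ⟩
  x ⊕ (x ⊕ y)  ≡⟨ cong (x ⊕_) eq ⟩
  x ⊕ (x ⊕ z)  ≡⟨ ⊕-assoc x x z ⟨
  x ⊕ x ⊕ z    ≡⟨ cong (_⊕ z) (⊕-self x) ⟩
  z            ∎
  where open ≡-Reasoning

⊕-exchange : (x y z : Z2²) → x ⊕ (y ⊕ z) ≡ y ⊕ (x ⊕ z)
⊕-exchange x y z = trans (sym (⊕-assoc x y z)) (trans (cong (_⊕ z) (⊕-comm x y)) (⊕-assoc y x z))

ι≢0Z : (x : 𝕂) → ι x ≢ 0Z
ι≢0Z κ₁ ()
ι≢0Z κ₂ ()
ι≢0Z κ₃ ()

ι≢ι⊕ι : ∀ x y → ι x ≢ ι x ⊕ ι y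
ι≢ι⊕ι x y eq = ι≢0Z y (sym (⊕-cancelˡ (ι x) (trans (⊕-identityʳ (ι x)) eq)))

sumZ-↭ : {xs ys : List Z2²} → xs ↭ ys → sumZ xs ≡ sumZ ys
sumZ-↭ ↭.refl           = refl
sumZ-↭ (prep x p)       = cong (x ⊕_) (sumZ-↭ p)
sumZ-↭ (swap x y p)     = trans (⊕-exchange x y _) (cong (λ s → y ⊕ (x ⊕ s)) (sumZ-↭ p))
sumZ-↭ (↭.trans p q)    = trans (sumZ-↭ p) (sumZ-↭ q)

record Finite (A : Set) : Set where
  field
    every       : (A → Bool) → Bool
    every-sound : ∀ p → T (every p) → ∀ x → T (p x)

open Finite ⦃ … ⦄

listed : {A : Set} (xs : List A) → (∀ x → x ∈ xs) → Finite A
listed xs complete = record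
  { every       = λ p → all p xs
  ; every-sound = λ p ok x → All.lookup (all⁺ p xs ok) (complete x) }

by-exhaustion⇒ : {A : Set} ⦃ _ : Finite A ⦄ (p q : A → Bool) →
                 T (every (λ t → not (p t) ∨ q t)) → ∀ t → T (p t) → T (q t)
by-exhaustion⇒ p q ok t pt with p t | every-sound (λ t → not (p t) ∨ q t) ok t
... | true | qt = qt

instance
  Bool-finite : Finite Bool
  Bool-finite = listed (false ∷ true ∷ []) λ { false → here refl ; true → there (here refl) }

  𝕂-finite : Finite 𝕂
  𝕂-finite = listed (κ₁ ∷ κ₂ ∷ κ₃ ∷ [])
    λ { κ₁ → here refl ; κ₂ → there (here refl) ; κ₃ → there (there (here refl)) }

  ×-finite : {A B : Set} ⦃ _ : Finite A ⦄ ⦃ _ : Finite B ⦄ → Finite (A × B)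
  ×-finite = record
    { every       = λ p → every (λ x → every (λ y → p (x , y)))
    ; every-sound = λ p ok (x , y) → every-sound _ (every-sound _ ok x) y }

infix 4 _≟ᶜ_ _≟ᶻ_ _≟ᵗ_ _≟ᵏ_
infixl 6 _+ᶜ_ _+ᵗ_
infix 9 _!_

_≟ᶜ_ : DecidableEquality 𝕂
κ₁ ≟ᶜ κ₁ = yes refl
κ₂ ≟ᶜ κ₂ = yes refl
κ₃ ≟ᶜ κ₃ = yes refl
κ₁ ≟ᶜ κ₂ = no λ ()
κ₁ ≟ᶜ κ₃ = no λ ()
κ₂ ≟ᶜ κ₁ = no λ ()
κ₂ ≟ᶜ κ₃ = no λ ()
κ₃ ≟ᶜ κ₁ = no λ ()
κ₃ ≟ᶜ κ₂ = no λ ()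

_≟ᶻ_ : DecidableEquality Z2²
_≟ᶻ_ = Product.≡-dec _≟ᵇ_ _≟ᵇ_

-- x +ᶜ x is junk (the true sum 0Z is not a colour); it is only applied to distinct colours.
_+ᶜ_ : 𝕂 → 𝕂 → 𝕂
κ₁ +ᶜ κ₂ = κ₃
κ₂ +ᶜ κ₁ = κ₃
κ₁ +ᶜ κ₃ = κ₂
κ₃ +ᶜ κ₁ = κ₂
κ₂ +ᶜ κ₃ = κ₁
κ₃ +ᶜ κ₂ = κ₁
x  +ᶜ _  = x

nextᶜ : 𝕂 → 𝕂
nextᶜ κ₁ = κ₂
nextᶜ κ₂ = κ₃
nextᶜ κ₃ = κ₁

otherColours : 𝕂 → List 𝕂
otherColours κ₁ = κ₂ ∷ κ₃ ∷ []
otherColours κ₂ = κ₁ ∷ κ₃ ∷ []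
otherColours κ₃ = κ₁ ∷ κ₂ ∷ []

data Triple : Set where
  tri : 𝕂 → 𝕂 → 𝕂 → Triple

data Pos : Set where
  p₁ p₂ p₃ : Pos

_!_ : Triple → Pos → 𝕂
tri x _ _ ! p₁ = x
tri _ y _ ! p₂ = y
tri _ _ z ! p₃ = z

toList : Triple → List 𝕂
toList (tri x y z) = x ∷ y ∷ z ∷ []

total : Triple → Z2²
total t = sumZ (map ι (toList t))

twist : Triple → Triple
twist (tri x y z) = tri x z y

twist-involutive : ∀ t → twist (twist t) ≡ t
twist-involutive (tri _ _ _) = refl

mapTriple : (𝕂 → 𝕂) → Triple → Triple
mapTriple f (tri x y z) = tri (f x) (f y) (f z)

_+ᵗ_ : Triple → Triple → Triple
tri x y z +ᵗ tri x′ y′ z′ = tri (x +ᶜ x′) (y +ᶜ y′) (z +ᶜ z′)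

_≟ᵗ_ : DecidableEquality Triple
tri x y z ≟ᵗ tri x′ y′ z′ =
  map′ (λ { (refl , refl , refl) → refl }) (λ { refl → refl , refl , refl })
       (x ≟ᶜ x′ ×-dec y ≟ᶜ y′ ×-dec z ≟ᶜ z′)

fromTuple : 𝕂 × 𝕂 × 𝕂 → Triple
fromTuple (x , y , z) = tri x y z

allTriples : List Triple
allTriples = map fromTuple (cartesianProduct colours (cartesianProduct colours colours))
  where colours = κ₁ ∷ κ₂ ∷ κ₃ ∷ []

instance
  Triple-finite : Finite Triple
  Triple-finite = record
    { every       = λ p → every (p ∘ fromTuple)
    ; every-sound = λ { p ok (tri x y z) → every-sound (p ∘ fromTuple) ok (x , y , z) } }

data Kind : Set where
  ka kb kc kd : Kind

_≟ᵏ_ : DecidableEquality Kind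
ka ≟ᵏ ka = yes refl
kb ≟ᵏ kb = yes refl
kc ≟ᵏ kc = yes refl
kd ≟ᵏ kd = yes refl
ka ≟ᵏ kb = no λ ()
ka ≟ᵏ kc = no λ ()
ka ≟ᵏ kd = no λ ()
kb ≟ᵏ ka = no λ ()
kb ≟ᵏ kc = no λ ()
kb ≟ᵏ kd = no λ ()
kc ≟ᵏ ka = no λ ()
kc ≟ᵏ kb = no λ ()
kc ≟ᵏ kd = no λ ()
kd ≟ᵏ ka = no λ ()
kd ≟ᵏ kb = no λ ()
kd ≟ᵏ kc = no λ ()

instance
  Kind-finite : Finite Kind
  Kind-finite = listed (ka ∷ kb ∷ kc ∷ kd ∷ [])
    λ { ka → here refl ; kb → there (here refl) ; kc → there (there (here refl))
      ; kd → there (there (there (here refl))) }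

-- Slice i has entering rail state x (colours of b_{i-1}b_i and of the c- and d-rail edges
-- entering c_i and d_i), spokes s (colours of a_ib_i, a_ic_i, a_id_i) and leaving rail
-- state y (colours of b_ib_{i+1}, cc i, dd i).  The colours at the three edge ends of the
-- vertex of kind κ, listed in the order of incidentEdges below, are star κ x s y.
star : Kind → Triple → Triple → Triple → Triple
star ka _ s _ = s
star kb (tri x _ _) (tri s _ _) (tri y _ _) = tri s y x
star kc (tri _ x _) (tri _ s _) (tri _ y _) = tri s y x
star kd (tri _ _ x) (tri _ _ s) (tri _ _ y) = tri s y x

balanced : Triple → Bool
balanced t = ⌊ total t ≟ᶻ 0Z ⌋

removes : Maybe Kind → Kind → Bool
removes m κ = ⌊ Maybe.≡-dec _≟ᵏ_ m (just κ) ⌋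

sliceOK : Maybe Kind → Triple → Triple → Triple → Bool
sliceOK m x s y = every (λ κ → removes m κ ∨ balanced (star κ x s y))

sliceOK-balanced : ∀ {m x s y} κ → T (sliceOK m x s y) → m ≢ just κ → total (star κ x s y) ≡ 0Z
sliceOK-balanced {m} {x} {s} {y} κ ok m≢κ
  with Equivalence.to (T-∨ {removes m κ}) (every-sound (λ κ → removes m κ ∨ balanced (star κ x s y)) ok κ)
... | inj₁ removed  = ⊥-elim (m≢κ (toWitness {a? = Maybe.≡-dec _≟ᵏ_ m (just κ)} removed))
... | inj₂ balance = toWitness {a? = total (star κ x s y) ≟ᶻ 0Z} balance

apart : Triple → Triple → Bool
apart (tri x y z) (tri x′ y′ z′) = not ⌊ x ≟ᶜ x′ ⌋ ∧ (not ⌊ y ≟ᶜ y′ ⌋ ∧ not ⌊ z ≟ᶜ z′ ⌋)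

-- An intact slice can lead from x to y exactly when this holds (its spokes are then x +ᵗ y).
adjacent : Triple → Triple → Bool
adjacent x y = apart x y ∧ ⌊ total x ≟ᶻ total y ⌋

cyclic : Triple → Bool
cyclic (tri x y _) = ⌊ y ≟ᶜ nextᶜ x ⌋

majority : Triple → 𝕂
majority (tri x y z) = if ⌊ x ≟ᶜ y ⌋ then x else z

-- A state of nonzero total repeats some colour (its majority), and is constant iff that colour
-- is its total; a balanced state is a permutation of κ₁κ₂κ₃ with a cyclic orientation.  Runs
-- of even (odd) length ≥ 2 join two states of equal total exactly when either both are balanced
-- with the same orientation, or both are non-constant with the same (different) majority.
linkedEven : Triple → Triple → Bool
linkedEven x y = ⌊ total x ≟ᶻ total y ⌋ ∧
  (if balanced x then ⌊ cyclic x ≟ᵇ cyclic y ⌋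
   else (not ⌊ ι (majority x) ≟ᶻ total x ⌋ ∧ ⌊ majority y ≟ᶜ majority x ⌋))

linkedOdd : Triple → Triple → Bool
linkedOdd x y = ⌊ total x ≟ᶻ total y ⌋ ∧
  (if balanced x then ⌊ cyclic x ≟ᵇ cyclic y ⌋
   else (not ⌊ ι (majority x) ≟ᶻ total x ⌋ ∧ (not ⌊ ι (majority y) ≟ᶻ total x ⌋
         ∧ not ⌊ majority y ≟ᶜ majority x ⌋)))

data Gap : Set where
  g₀ g₁ gₑ gₒ : Gap

instance
  Gap-finite : Finite Gap
  Gap-finite = listed (g₀ ∷ g₁ ∷ gₑ ∷ gₒ ∷ [])
    λ { g₀ → here refl ; g₁ → there (here refl) ; gₑ → there (there (here refl))
      ; gₒ → there (there (there (here refl))) }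

gapOf : ℕ → Gap
gapOf 0 = g₀
gapOf 1 = g₁
gapOf 2 = gₑ
gapOf 3 = gₒ
gapOf (suc (suc (suc (suc n)))) = gapOf (suc (suc n))

linked : Gap → Triple → Triple → Bool
linked g₀ x y = ⌊ x ≟ᵗ y ⌋
linked g₁ = adjacent
linked gₑ = linkedEven
linked gₒ = linkedOdd

infixl 6 _⊞_
_⊞_ : Gap → Gap → Gap
g₀ ⊞ g  = g
g₁ ⊞ g₀ = g₁
g₁ ⊞ g₁ = gₑ
g₁ ⊞ gₑ = gₒ
g₁ ⊞ gₒ = gₑ
gₑ ⊞ g₀ = gₑ
gₑ ⊞ g₁ = gₒ
gₑ ⊞ gₑ = gₑ
gₑ ⊞ gₒ = gₒ
gₒ ⊞ g₀ = gₒ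
gₒ ⊞ g₁ = gₑ
gₒ ⊞ gₑ = gₒ
gₒ ⊞ gₒ = gₑ

⊞-assoc-g₁ : ∀ g h → g₁ ⊞ g ⊞ h ≡ g₁ ⊞ (g ⊞ h)
⊞-assoc-g₁ g₀ h  = refl
⊞-assoc-g₁ g₁ g₀ = refl
⊞-assoc-g₁ g₁ g₁ = refl
⊞-assoc-g₁ g₁ gₑ = refl
⊞-assoc-g₁ g₁ gₒ = refl
⊞-assoc-g₁ gₑ g₀ = refl
⊞-assoc-g₁ gₑ g₁ = refl
⊞-assoc-g₁ gₑ gₑ = refl
⊞-assoc-g₁ gₑ gₒ = refl
⊞-assoc-g₁ gₒ g₀ = refl
⊞-assoc-g₁ gₒ g₁ = refl
⊞-assoc-g₁ gₒ gₑ = refl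
⊞-assoc-g₁ gₒ gₒ = refl

gapOf-suc : ∀ n → gapOf (suc n) ≡ g₁ ⊞ gapOf n
gapOf-suc 0 = refl
gapOf-suc 1 = refl
gapOf-suc 2 = refl
gapOf-suc 3 = refl
gapOf-suc (suc (suc (suc (suc n)))) = gapOf-suc (suc (suc n))

gapOf-+ : ∀ m n → gapOf (m + n) ≡ gapOf m ⊞ gapOf n
gapOf-+ zero    n = refl
gapOf-+ (suc m) n = begin
  gapOf (suc (m + n))          ≡⟨ gapOf-suc (m + n) ⟩
  g₁ ⊞ gapOf (m + n)           ≡⟨ cong (g₁ ⊞_) (gapOf-+ m n) ⟩
  g₁ ⊞ (gapOf m ⊞ gapOf n)     ≡⟨ ⊞-assoc-g₁ (gapOf m) (gapOf n) ⟨
  g₁ ⊞ gapOf m ⊞ gapOf n       ≡⟨ cong (_⊞ gapOf n) (gapOf-suc m) ⟨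
  gapOf (suc m) ⊞ gapOf n      ∎
  where open ≡-Reasoning

gapOf-odd : ∀ m → gapOf (suc (suc m + suc m)) ≡ gₒ
gapOf-odd m = begin
  gapOf (suc (suc m + suc m))                ≡⟨ gapOf-suc (suc m + suc m) ⟩
  g₁ ⊞ gapOf (suc m + suc m)                 ≡⟨ cong (g₁ ⊞_) (gapOf-+ (suc m) (suc m)) ⟩
  g₁ ⊞ (gapOf (suc m) ⊞ gapOf (suc m))       ≡⟨ cong (λ g → g₁ ⊞ (g ⊞ g)) (gapOf-suc m) ⟩
  g₁ ⊞ (g₁ ⊞ gapOf m ⊞ (g₁ ⊞ gapOf m))       ≡⟨ odd-class (gapOf m) ⟩
  gₒ                                         ∎
  where
  open ≡-Reasoning
  odd-class : ∀ g → g₁ ⊞ (g₁ ⊞ g ⊞ (g₁ ⊞ g)) ≡ gₒ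
  odd-class g₀ = refl
  odd-class g₁ = refl
  odd-class gₑ = refl
  odd-class gₒ = refl

gapOf≡g₀ : ∀ n → gapOf n ≡ g₀ → n ≡ 0
gapOf≡g₀ zero    _  = refl
gapOf≡g₀ (suc n) eq = ⊥-elim (g₁⊞≢g₀ (gapOf n) (trans (sym (gapOf-suc n)) eq))
  where
  g₁⊞≢g₀ : ∀ g → g₁ ⊞ g ≢ g₀
  g₁⊞≢g₀ g₀ ()
  g₁⊞≢g₀ g₁ ()
  g₁⊞≢g₀ gₑ ()
  g₁⊞≢g₀ gₒ ()

gapOf≡g₁ : ∀ n → gapOf n ≡ g₁ → n ≡ 1
gapOf≡g₁ (suc n) eq = cong suc (gapOf≡g₀ n (g₁⊞≡g₁ (gapOf n) (trans (sym (gapOf-suc n)) eq)))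
  where
  g₁⊞≡g₁ : ∀ g → g₁ ⊞ g ≡ g₁ → g ≡ g₀
  g₁⊞≡g₁ g₀ _ = refl
  g₁⊞≡g₁ g₁ ()
  g₁⊞≡g₁ gₑ ()
  g₁⊞≡g₁ gₒ ()

record Slice : Set where
  constructor mkSlice
  field
    removed : Maybe Kind
    spokes  : Triple
    output  : Triple

open Slice

Intact : Slice → Set
Intact σ = removed σ ≡ nothing

Run : Triple → List Slice → Triple → Set
Run x []                   y = x ≡ y
Run x (mkSlice m s z ∷ σs) y = T (sliceOK m x s z) × Run z σs y

Run-++ : ∀ {x y z} σs {τs} → Run x σs y → Run y τs z → Run x (σs ++ τs) z
Run-++ []                   refl     ρ′ = ρ′
Run-++ (mkSlice _ _ _ ∷ σs) (ok , ρ) ρ′ = ok , Run-++ σs ρ ρ′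

Run-split : ∀ {x z} σs {τs} → Run x (σs ++ τs) z → ∃[ y ] Run x σs y × Run y τs z
Run-split {x} []                   ρ        = x , refl , ρ
Run-split     (mkSlice _ _ _ ∷ σs) (ok , ρ) = let y , ρ₁ , ρ₂ = Run-split σs ρ in y , (ok , ρ₁) , ρ₂

twistSlice : Slice → Slice
twistSlice (mkSlice m s y) = mkSlice m (twist s) (twist y)

sliceOK-twist : ∀ x s y → T (sliceOK nothing x s y) → T (sliceOK nothing (twist x) (twist s) (twist y))
sliceOK-twist x s y = by-exhaustion⇒
  (λ (x , s , y) → sliceOK nothing x s y)
  (λ (x , s , y) → sliceOK nothing (twist x) (twist s) (twist y)) tt (x , s , y)

Run-twist : ∀ {x y σs} → All Intact σs → Run x σs y → Run (twist x) (map twistSlice σs) (twist y)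
Run-twist []                                    refl     = refl
Run-twist {x} {σs = mkSlice _ s z ∷ _} (refl ∷ intact) (ok , ρ) = sliceOK-twist x s z ok , Run-twist intact ρ

record Walk (L : ℕ) (x y : Triple) : Set where
  constructor walk
  field
    slices  : List Slice
    length≡ : length slices ≡ L
    intact  : All Intact slices
    run     : Run x slices y

adjacent-sliceOK : ∀ x y → T (adjacent x y) → T (sliceOK nothing x (x +ᵗ y) y)
adjacent-sliceOK x y = by-exhaustion⇒
  (λ (x , y) → adjacent x y) (λ (x , y) → sliceOK nothing x (x +ᵗ y) y) tt (x , y)

adjacent-sym : ∀ x y → T (adjacent x y) → T (adjacent y x)
adjacent-sym x y = by-exhaustion⇒ (λ (x , y) → adjacent x y) (λ (x , y) → adjacent y x) tt (x , y)

midpoint : Triple → Triple → Triple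
midpoint x y = fromMaybe x (findᵇ (λ z → adjacent x z ∧ adjacent z y) allTriples)

linkedEven-midpoint : ∀ x y → T (linkedEven x y) →
                      T (adjacent x (midpoint x y)) × T (adjacent (midpoint x y) y)
linkedEven-midpoint x y h = Equivalence.to T-∧ (by-exhaustion⇒
  (λ (x , y) → linkedEven x y)
  (λ (x , y) → adjacent x (midpoint x y) ∧ adjacent (midpoint x y) y) tt (x , y) h)

firstStep : Triple → Triple → Triple
firstStep x y = fromMaybe x (findᵇ (λ z → adjacent x z ∧ linkedEven z y) allTriples)

linkedOdd-firstStep : ∀ x y → T (linkedOdd x y) →
                      T (adjacent x (firstStep x y)) × T (linkedEven (firstStep x y) y)
linkedOdd-firstStep x y h = Equivalence.to T-∧ (by-exhaustion⇒
  (λ (x , y) → linkedOdd x y)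
  (λ (x , y) → adjacent x (firstStep x y) ∧ linkedEven (firstStep x y) y) tt (x , y) h)

stay : ∀ {x} → Walk 0 x x
stay = walk [] refl [] refl

infixr 5 _◅_
_◅_ : ∀ {L x y z} → T (adjacent x y) → Walk L y z → Walk (suc L) x z
_◅_ {x = x} {y} adj (walk σs len intact ρ) =
  walk (mkSlice nothing (x +ᵗ y) y ∷ σs) (cong suc len) (refl ∷ intact) (adjacent-sliceOK x y adj , ρ)

linked-neighbour : ∀ n x y → T (linked (gapOf (suc (suc n))) x y) → ∃[ z ] T (adjacent x z)
linked-neighbour 0 x y h = midpoint x y , proj₁ (linkedEven-midpoint x y h)
linked-neighbour 1 x y h = firstStep x y , proj₁ (linkedOdd-firstStep x y h)
linked-neighbour (suc (suc n)) = linked-neighbour n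

-- Walks of length ≥ 4 come from shorter ones by stepping to a neighbour and back.
walkOf : ∀ L x y → T (linked (gapOf L) x y) → Walk L x y
walkOf 0 x y h = walk [] refl [] (toWitness {a? = x ≟ᵗ y} h)
walkOf 1 x y h = h ◅ stay
walkOf 2 x y h = let first , second = linkedEven-midpoint x y h in first ◅ second ◅ stay
walkOf 3 x y h = let first , rest = linkedOdd-firstStep x y h in first ◅ walkOf 2 _ y rest
walkOf (suc (suc (suc (suc n)))) x y h =
  let z , x~z = linked-neighbour n x y h in x~z ◅ adjacent-sym x z x~z ◅ walkOf (suc (suc n)) x y h

otherPairs : 𝕂 → List (𝕂 × 𝕂)
otherPairs x = map (λ y → y , x +ᶜ y) (otherColours x)

-- Every slice with the given star at κ that satisfies Kirchhoff's law at the other three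
-- vertices of the slice.
slicesWithStar : Kind → Triple → List (Triple × Triple × Triple)
slicesWithStar ka s =
  concatMap (λ xb → concatMap (λ xc → map (λ xd → let x = tri xb xc xd in x , s , x +ᵗ s)
    (otherColours (s ! p₃))) (otherColours (s ! p₂))) (otherColours (s ! p₁))
slicesWithStar kb (tri sb yb xb) =
  concatMap (λ (sc , sd) → concatMap (λ xc → map (λ xd →
    tri xb xc xd , tri sb sc sd , tri yb (xc +ᶜ sc) (xd +ᶜ sd)) (otherColours sd)) (otherColours sc))
    (otherPairs sb)
slicesWithStar kc (tri sc yc xc) =
  concatMap (λ (sb , sd) → concatMap (λ xb → map (λ xd →
    tri xb xc xd , tri sb sc sd , tri (xb +ᶜ sb) yc (xd +ᶜ sd)) (otherColours sd)) (otherColours sb))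
    (otherPairs sc)
slicesWithStar kd (tri sd yd xd) =
  concatMap (λ (sb , sc) → concatMap (λ xb → map (λ xc →
    tri xb xc xd , tri sb sc sd , tri (xb +ᶜ sb) (xc +ᶜ sc) yd) (otherColours sc)) (otherColours sb))
    (otherPairs sd)

data Order : Set where
  u-first v-first : Order

instance
  Order-finite : Finite Order
  Order-finite = listed (u-first ∷ v-first ∷ []) λ { u-first → here refl ; v-first → there (here refl) }

  Pos-finite : Finite Pos
  Pos-finite = listed (p₁ ∷ p₂ ∷ p₃ ∷ [])
    λ { p₁ → here refl ; p₂ → there (here refl) ; p₃ → there (there (here refl)) }

record Solution : Set where
  constructor solution
  field
    xᵤ sᵤ yᵤ xᵥ sᵥ yᵥ : Triple

-- A case (o , g , g′ , κᵤ , κᵥ , V , α , j): o says which of u and v lies in the earlier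
-- slice, g and g′ are the gap classes from that slice forward to the other one and from the
-- other one forward, across the crossing of the c- and d-rails, back to it; κᵤ and κᵥ are
-- the kinds of u and v; the semiedges at v should get the colours V and the j-th one at u
-- the colour α.
Case : Set
Case = Order × Gap × Gap × Kind × Kind × Triple × 𝕂 × Pos

linksOK : Order → Gap → Gap → Solution → Bool
linksOK u-first g g′ (solution xᵤ _ yᵤ xᵥ _ yᵥ) = linked g yᵤ xᵥ ∧ linked g′ yᵥ (twist xᵤ)
linksOK v-first g g′ (solution xᵤ _ yᵤ xᵥ _ yᵥ) = linked g yᵥ xᵤ ∧ linked g′ yᵤ (twist xᵥ)

Solves : Case → Solution → Set
Solves (o , g , g′ , κᵤ , κᵥ , V , α , j) σ@(solution xᵤ sᵤ yᵤ xᵥ sᵥ yᵥ) =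
  T (linksOK o g g′ σ) × T (sliceOK (just κᵤ) xᵤ sᵤ yᵤ) × T (sliceOK (just κᵥ) xᵥ sᵥ yᵥ)
  × star κᵥ xᵥ sᵥ yᵥ ≡ V × star κᵤ xᵤ sᵤ yᵤ ! j ≡ α × total (star κᵤ xᵤ sᵤ yᵤ) ≡ total V

solves? : ∀ ξ σ → Dec (Solves ξ σ)
solves? (o , g , g′ , κᵤ , κᵥ , V , α , j) σ@(solution xᵤ sᵤ yᵤ xᵥ sᵥ yᵥ) =
  T? (linksOK o g g′ σ) ×-dec T? (sliceOK (just κᵤ) xᵤ sᵤ yᵤ) ×-dec T? (sliceOK (just κᵥ) xᵥ sᵥ yᵥ)
  ×-dec star κᵥ xᵥ sᵥ yᵥ ≟ᵗ V ×-dec star κᵤ xᵤ sᵤ yᵤ ! j ≟ᶜ α ×-dec total (star κᵤ xᵤ sᵤ yᵤ) ≟ᶻ total V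

search : Case → Maybe Solution
search ξ@(_ , _ , _ , κᵤ , κᵥ , V , α , j) = findᵇ (λ σ → ⌊ solves? ξ σ ⌋)
  (concatMap (λ U → concatMap (λ (xᵤ , sᵤ , yᵤ) → map (λ (xᵥ , sᵥ , yᵥ) → solution xᵤ sᵤ yᵤ xᵥ sᵥ yᵥ)
    (slicesWithStar κᵥ V)) (slicesWithStar κᵤ U))
  (filterᵇ (λ U → ⌊ U ! j ≟ᶜ α ⌋ ∧ ⌊ total U ≟ᶻ total V ⌋) allTriples))

-- Pairs (κ , κ′) such that the vertex of kind κ in slice i and the vertex of kind κ′ in slice
-- i + 1 (for g₀) or i + 2 (for g₁) are at distance at most 2; the Boolean records whether the
-- c- and d-rails are exchanged on the way.
nearPairs : Gap → Bool → List (Kind × Kind)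
nearPairs g₀ false = (ka , kb) ∷ (ka , kc) ∷ (ka , kd) ∷ (kb , ka) ∷ (kb , kb) ∷ (kc , ka)
                   ∷ (kc , kc) ∷ (kd , ka) ∷ (kd , kd) ∷ []
nearPairs g₀ true  = (ka , kb) ∷ (ka , kc) ∷ (ka , kd) ∷ (kb , ka) ∷ (kb , kb) ∷ (kc , ka)
                   ∷ (kc , kd) ∷ (kd , ka) ∷ (kd , kc) ∷ []
nearPairs g₁ false = (kb , kb) ∷ (kc , kc) ∷ (kd , kd) ∷ []
nearPairs g₁ true  = (kb , kb) ∷ (kc , kd) ∷ (kd , kc) ∷ []
nearPairs _  _     = []

near : Gap → Bool → Kind → Kind → Bool
near g crossed κ κ′ = ⌊ any? (Product.≡-dec _≟ᵏ_ _≟ᵏ_ (κ , κ′)) (nearPairs g crossed) ⌋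

tooClose : Order → Gap → Gap → Kind → Kind → Bool
tooClose u-first g g′ κᵤ κᵥ = near g false κᵤ κᵥ ∨ near g′ true κᵥ κᵤ
tooClose v-first g g′ κᵤ κᵥ = near g false κᵥ κᵤ ∨ near g′ true κᵤ κᵥ

oddGap : Gap → Bool
oddGap gₒ = true
oddGap _  = false

normalised : Triple → 𝕂 → Bool
normalised V α = ⌊ total V ≟ᶻ ι κ₃ ⌋ ∧ ⌊ α ≟ᶜ κ₁ ⌋

admissible : Case → Bool
admissible (o , g , g′ , κᵤ , κᵥ , V , α , _) =
  oddGap (g ⊞ g′) ∧ (not (tooClose o g g′ κᵤ κᵥ) ∧ normalised V α)

found : ∀ ξ (m : Maybe Solution) → T (maybe′ (λ σ → ⌊ solves? ξ σ ⌋) false m) → ∃[ σ ] Solves ξ σ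
found ξ (just σ) solved = σ , toWitness solved

abstract
  search-succeeds : ∀ ξ → T (admissible ξ) → T (maybe′ (λ σ → ⌊ solves? ξ σ ⌋) false (search ξ))
  search-succeeds = by-exhaustion⇒ admissible (λ ξ → maybe′ (λ σ → ⌊ solves? ξ σ ⌋) false (search ξ)) tt

solution-exists : ∀ ξ → T (admissible ξ) → ∃[ σ ] Solves ξ σ
solution-exists ξ ok = found ξ (search ξ) (search-succeeds ξ ok)

data NextView {n} (i : Fin (suc n)) : Set where
  inner : toℕ i < n → toℕ (nxt i) ≡ suc (toℕ i) → isLast i ≡ false → NextView i
  last  : toℕ i ≡ n → nxt i ≡ zero → isLast i ≡ true → NextView i

nextView : ∀ {n} (i : Fin (suc n)) → NextView i
nextView {n} i with suc (toℕ i) <? suc n in eq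
... | yes i<n = inner (≤-pred i<n) toℕ-nxt (cong not (dec-true (suc (toℕ i) <? suc n) i<n))
  where
  toℕ-nxt : toℕ (nxt i) ≡ suc (toℕ i)
  toℕ-nxt rewrite eq = toℕ-fromℕ< i<n
... | no  i≮n = last (≤-antisym (≤-pred (toℕ<n i)) (≤-pred (≮⇒≥ i≮n))) nxt≡0
                     (cong not (dec-false (suc (toℕ i) <? suc n) i≮n))
  where
  nxt≡0 : nxt i ≡ zero
  nxt≡0 rewrite eq = refl

prev : ∀ {k} → Fin k → Fin k
prev {suc n} zero    = fromℕ n
prev {suc n} (suc i) = inject₁ i

toℕ-prev : ∀ {n} (j : Fin (suc n)) → toℕ j ≡ 0 × toℕ (prev j) ≡ n ⊎ toℕ j ≡ suc (toℕ (prev j))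
toℕ-prev zero            = inj₁ (refl , toℕ-fromℕ _)
toℕ-prev {suc n} (suc i) = inj₂ (cong suc (sym (toℕ-inject₁ i)))

prev-nxt : ∀ {n} (i : Fin (suc n)) → prev (nxt i) ≡ i
prev-nxt i = toℕ-injective (from-views (nextView i) (toℕ-prev (nxt i)))
  where
  from-views : NextView i → _ → toℕ (prev (nxt i)) ≡ toℕ i
  from-views (inner _ eq _) (inj₁ (eq′ , _)) = contradiction (trans (sym eq) eq′) λ ()
  from-views (inner _ eq _) (inj₂ eq′)       = suc-injective (trans (sym eq′) eq)
  from-views (last i≡n _ _) (inj₁ (_ , eq′)) = trans eq′ (sym i≡n)
  from-views (last _ eq _)  (inj₂ eq′)       = contradiction (trans (sym eq′) (cong toℕ eq)) λ ()

nxt-prev : ∀ {n} (j : Fin (suc n)) → nxt (prev j) ≡ j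
nxt-prev {n} j = toℕ-injective (from-views (nextView (prev j)) (toℕ-prev j))
  where
  from-views : NextView (prev j) → _ → toℕ (nxt (prev j)) ≡ toℕ j
  from-views (inner p<n _ _) (inj₁ (_ , p≡n)) = contradiction p≡n (<⇒≢ p<n)
  from-views (inner _ eq _)  (inj₂ eq′)       = trans eq (sym eq′)
  from-views (last _ eq _)   (inj₁ (eq′ , _)) = trans (cong toℕ eq) (sym eq′)
  from-views (last p≡n _ _)  (inj₂ eq′)       =
    contradiction (subst (_< suc n) (trans eq′ (cong suc p≡n)) (toℕ<n j)) (n≮n (suc n))

nxt≡⇒≡prev : ∀ {n} {i j : Fin (suc n)} → nxt i ≡ j → i ≡ prev j
nxt≡⇒≡prev {i = i} refl = sym (prev-nxt i)

prev≢ : ∀ {n} (j : Fin (suc (suc n))) → prev j ≢ j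
prev≢ j eq with toℕ-prev j
... | inj₁ (j≡0 , p≡n) = contradiction (trans (sym p≡n) (trans (cong toℕ eq) j≡0)) λ ()
... | inj₂ j≡1+p       = 1+n≢n (trans (sym j≡1+p) (cong toℕ (sym eq)))

nxt-of-suc : ∀ {n} {i j : Fin (suc n)} → toℕ j ≡ suc (toℕ i) → nxt i ≡ j × isLast i ≡ false
nxt-of-suc {n} {i} {j} j≡1+i with nextView i
... | inner _ toℕ-nxt cross = toℕ-injective (trans toℕ-nxt (sym j≡1+i)) , cross
... | last i≡n _ _ = contradiction (subst (_< suc n) (trans j≡1+i (cong suc i≡n)) (toℕ<n j)) (n≮n (suc n))

nxt-of-last : ∀ {n} {i j : Fin (suc n)} → toℕ i ≡ n → toℕ j ≡ 0 → nxt i ≡ j × isLast i ≡ true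
nxt-of-last {i = i} i≡n j≡0 with nextView i
... | inner i<n _ _       = contradiction i≡n (<⇒≢ i<n)
... | last _ nxt≡0 cross = trans nxt≡0 (toℕ-injective (sym j≡0)) , cross

vertex : ∀ {k} → Kind → Fin k → Vtx k
vertex ka = a
vertex kb = b
vertex kc = c
vertex kd = d

kind : ∀ {k} → Vtx k → Kind
kind (a _) = ka
kind (b _) = kb
kind (c _) = kc
kind (d _) = kd

slot : ∀ {k} → Vtx k → Fin k
slot (a i) = i
slot (b i) = i
slot (c i) = i
slot (d i) = i

vertex-kind-slot : ∀ {k} (w : Vtx k) → vertex (kind w) (slot w) ≡ w
vertex-kind-slot (a _) = refl
vertex-kind-slot (b _) = refl
vertex-kind-slot (c _) = refl
vertex-kind-slot (d _) = refl

cEntering dEntering : ∀ {k} → Fin k → Edge k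
cEntering j = if isLast (prev j) then dd (prev j) else cc (prev j)
dEntering j = if isLast (prev j) then cc (prev j) else dd (prev j)

incident : ∀ {k} → Vtx k → Pos → Edge k
incident (a j) p₁ = ab j
incident (a j) p₂ = ac j
incident (a j) p₃ = ad j
incident (b j) p₁ = ab j
incident (b j) p₂ = bb j
incident (b j) p₃ = bb (prev j)
incident (c j) p₁ = ac j
incident (c j) p₂ = cc j
incident (c j) p₃ = cEntering j
incident (d j) p₁ = ad j
incident (d j) p₂ = dd j
incident (d j) p₃ = dEntering j

incidentEdges : ∀ {k} → Vtx k → List (Edge k)
incidentEdges w = incident w p₁ ∷ incident w p₂ ∷ incident w p₃ ∷ []

-- The local function of Defs.endsAt, which concatenates endsOf w e over all edges e.
endsOf : ∀ {k} → Vtx k → Edge k → List (Edge k)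
endsOf w e = (if does (proj₁ (ends e) ≟ᵛ w) then e ∷ [] else [])
          ++ (if does (proj₂ (ends e) ≟ᵛ w) then e ∷ [] else [])

block : ∀ {k} → Fin k → List (Edge k)
block i = ab i ∷ ac i ∷ ad i ∷ bb i ∷ cc i ∷ dd i ∷ []

endsAt-blocks : ∀ {k} (w : Vtx k) → endsAt w ≡ concatMap (concatMap (endsOf w) ∘ block) (allFin k)
endsAt-blocks {k} w = concatMap-concatMap (allFin k)
  where
  concatMap-concatMap : ∀ {A B C : Set} {f : B → List C} {g : A → List B} xs →
                        concatMap f (concatMap g xs) ≡ concatMap (concatMap f ∘ g) xs
  concatMap-concatMap         []       = refl
  concatMap-concatMap {f = f} {g} (x ∷ xs) =
    trans (concatMap-++ f (g x) (concatMap g xs)) (cong (concatMap f (g x) ++_) (concatMap-concatMap xs))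

sel : ∀ {A : Set} → Bool → A → List A
sel β x = if β then x ∷ [] else []

does-≟ᵛ : ∀ {k} κ (i j : Fin k) → does (vertex κ i ≟ᵛ vertex κ j) ≡ does (i ≟ᶠ j)
does-≟ᵛ ka i j with i ≟ᶠ j
... | yes refl = refl
... | no  _    = refl
does-≟ᵛ kb i j with i ≟ᶠ j
... | yes refl = refl
... | no  _    = refl
does-≟ᵛ kc i j with i ≟ᶠ j
... | yes refl = refl
... | no  _    = refl
does-≟ᵛ kd i j with i ≟ᶠ j
... | yes refl = refl
... | no  _    = refl

block-a : ∀ {n} (j i : Fin (suc n)) → concatMap (endsOf (a j)) (block i) ↭
          sel (does (i ≟ᶠ j)) (ab i) ++ sel (does (i ≟ᶠ j)) (ac i) ++ sel (does (i ≟ᶠ j)) (ad i)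
block-a j i with isLast i
... | true rewrite does-≟ᵛ ka i j with does (i ≟ᶠ j)
...   | true  = ↭-refl
...   | false = ↭-refl
block-a j i | false rewrite does-≟ᵛ ka i j with does (i ≟ᶠ j)
...   | true  = ↭-refl
...   | false = ↭-refl

block-b : ∀ {n} (j i : Fin (suc n)) → concatMap (endsOf (b j)) (block i) ↭
          sel (does (i ≟ᶠ j)) (ab i) ++ sel (does (i ≟ᶠ j)) (bb i) ++ sel (does (nxt i ≟ᶠ j)) (bb i)
block-b j i with isLast i
... | true rewrite does-≟ᵛ kb i j | does-≟ᵛ kb (nxt i) j with does (i ≟ᶠ j) | does (nxt i ≟ᶠ j)
...   | true  | true  = ↭-refl
...   | true  | false = ↭-refl
...   | false | true  = ↭-refl
...   | false | false = ↭-refl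
block-b j i | false rewrite does-≟ᵛ kb i j | does-≟ᵛ kb (nxt i) j with does (i ≟ᶠ j) | does (nxt i ≟ᶠ j)
...   | true  | true  = ↭-refl
...   | true  | false = ↭-refl
...   | false | true  = ↭-refl
...   | false | false = ↭-refl

block-c : ∀ {n} (j i : Fin (suc n)) → concatMap (endsOf (c j)) (block i) ↭
          sel (does (i ≟ᶠ j)) (ac i) ++ sel (does (i ≟ᶠ j)) (cc i)
          ++ sel (does (nxt i ≟ᶠ j)) (if isLast i then dd i else cc i)
block-c j i with isLast i
... | true rewrite does-≟ᵛ kc i j | does-≟ᵛ kc (nxt i) j with does (i ≟ᶠ j) | does (nxt i ≟ᶠ j)
...   | true  | true  = ↭-refl
...   | true  | false = ↭-refl
...   | false | true  = ↭-refl
...   | false | false = ↭-refl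
block-c j i | false rewrite does-≟ᵛ kc i j | does-≟ᵛ kc (nxt i) j with does (i ≟ᶠ j) | does (nxt i ≟ᶠ j)
...   | true  | true  = ↭-refl
...   | true  | false = ↭-refl
...   | false | true  = ↭-refl
...   | false | false = ↭-refl

block-d : ∀ {n} (j i : Fin (suc n)) → concatMap (endsOf (d j)) (block i) ↭
          sel (does (i ≟ᶠ j)) (ad i) ++ sel (does (i ≟ᶠ j)) (dd i)
          ++ sel (does (nxt i ≟ᶠ j)) (if isLast i then cc i else dd i)
block-d j i with isLast i
... | true rewrite does-≟ᵛ kd i j | does-≟ᵛ kd (nxt i) j with does (i ≟ᶠ j) | does (nxt i ≟ᶠ j)
...   | true  | true  = prep (ad i) (swap (cc i) (dd i) ↭-refl)
...   | true  | false = ↭-refl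
...   | false | true  = ↭-refl
...   | false | false = ↭-refl
block-d j i | false rewrite does-≟ᵛ kd i j | does-≟ᵛ kd (nxt i) j with does (i ≟ᶠ j) | does (nxt i ≟ᶠ j)
...   | true  | true  = ↭-refl
...   | true  | false = ↭-refl
...   | false | true  = ↭-refl
...   | false | false = ↭-refl

concatMap-↭ : ∀ {A B : Set} {f g : A → List B} → (∀ x → f x ↭ g x) → ∀ xs → concatMap f xs ↭ concatMap g xs
concatMap-↭ f↭g []       = ↭-refl
concatMap-↭ f↭g (x ∷ xs) = ++⁺ (f↭g x) (concatMap-↭ f↭g xs)

concatMap-++-↭ : ∀ {A B : Set} (f g : A → List B) xs →
                 concatMap (λ x → f x ++ g x) xs ↭ concatMap f xs ++ concatMap g xs
concatMap-++-↭ f g []       = ↭-refl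
concatMap-++-↭ f g (x ∷ xs) = begin
  (f x ++ g x) ++ concatMap (λ x → f x ++ g x) xs  ≡⟨ ++-assoc (f x) (g x) _ ⟩
  f x ++ g x ++ concatMap (λ x → f x ++ g x) xs    ↭⟨ ++⁺ˡ (f x) (++⁺ˡ (g x) (concatMap-++-↭ f g xs)) ⟩
  f x ++ g x ++ concatMap f xs ++ concatMap g xs    ↭⟨ ++⁺ˡ (f x) (shifts (g x) (concatMap f xs)) ⟩
  f x ++ concatMap f xs ++ g x ++ concatMap g xs    ≡⟨ ++-assoc (f x) (concatMap f xs) _ ⟨
  (f x ++ concatMap f xs) ++ g x ++ concatMap g xs  ∎
  where open PermutationReasoning

concatMap-single : ∀ {k} {B : Set} (h : Fin k → List B) (j : Fin k) → (∀ i → i ≢ j → h i ≡ []) →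
                   concatMap h (allFin k) ≡ h j
concatMap-single h zero    off = begin
  h zero ++ concatMap h (map suc (allFin _))  ≡⟨ cong (h zero ++_) (concatMap-map h suc (allFin _)) ⟩
  h zero ++ concatMap (h ∘ suc) (allFin _)    ≡⟨ cong (h zero ++_) (concatMap-[] (h ∘ suc) (λ i → off (suc i) λ ())
                                                                                (allFin _)) ⟩
  h zero ++ []                               ≡⟨ ++-identityʳ (h zero) ⟩
  h zero                                     ∎
  where
  open ≡-Reasoning
  concatMap-[] : ∀ {A C : Set} (f : A → List C) → (∀ x → f x ≡ []) → ∀ xs → concatMap f xs ≡ []
  concatMap-[] f none []       = refl
  concatMap-[] f none (x ∷ xs) = cong₂ _++_ (none x) (concatMap-[] f none xs)
concatMap-single h (suc j) off = begin
  h zero ++ concatMap h (map suc (allFin _))      ≡⟨ cong (_++ concatMap h (map suc (allFin _))) (off zero λ ()) ⟩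
  concatMap h (map suc (allFin _))               ≡⟨ concatMap-map h suc (allFin _) ⟩
  concatMap (h ∘ suc) (allFin _)                 ≡⟨ concatMap-single (h ∘ suc) j
                                                      (λ i i≢j → off (suc i) (i≢j ∘ Fin.suc-injective)) ⟩
  h (suc j)                                      ∎
  where open ≡-Reasoning

selected : ∀ {n} {E : Set} (h : Fin (suc n) → Fin (suc n)) (e : Fin (suc n) → E) {j j′} →
           (∀ {i} → h i ≡ j → i ≡ j′) → h j′ ≡ j →
           concatMap (λ i → sel (does (h i ≟ᶠ j)) (e i)) (allFin (suc n)) ≡ e j′ ∷ []
selected h e {j} {j′} onlyAt hits = trans
  (concatMap-single _ j′ (λ i i≢j′ → cong (λ β → sel β (e i)) (dec-false (h i ≟ᶠ j) (i≢j′ ∘ onlyAt))))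
  (cong (λ β → sel β (e j′)) (dec-true (h j′ ≟ᶠ j) hits))

gather : ∀ {n} {E : Set} (e₁ e₂ e₃ : Fin (suc n) → E) (σ : Fin (suc n) → Fin (suc n)) {j j′} →
         (∀ {i} → σ i ≡ j → i ≡ j′) → σ j′ ≡ j →
         concatMap (λ i → sel (does (i ≟ᶠ j)) (e₁ i) ++ sel (does (i ≟ᶠ j)) (e₂ i) ++ sel (does (σ i ≟ᶠ j)) (e₃ i))
                   (allFin (suc n))
         ↭ e₁ j ∷ e₂ j ∷ e₃ j′ ∷ []
gather e₁ e₂ e₃ σ onlyAt hits = begin
  concatMap (λ i → P₁ i ++ P₂ i ++ P₃ i) xs             ↭⟨ concatMap-++-↭ P₁ (λ i → P₂ i ++ P₃ i) xs ⟩
  concatMap P₁ xs ++ concatMap (λ i → P₂ i ++ P₃ i) xs   ↭⟨ ++⁺ˡ (concatMap P₁ xs) (concatMap-++-↭ P₂ P₃ xs) ⟩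
  concatMap P₁ xs ++ concatMap P₂ xs ++ concatMap P₃ xs  ≡⟨ cong₂ _++_ (selected id e₁ id refl)
                                                             (cong₂ _++_ (selected id e₂ id refl)
                                                                         (selected σ e₃ onlyAt hits)) ⟩
  _ ∷ _ ∷ _ ∷ []                                        ∎
  where
  open PermutationReasoning
  xs = allFin _
  P₁ = λ i → sel (does (i ≟ᶠ _)) (e₁ i)
  P₂ = λ i → sel (does (i ≟ᶠ _)) (e₂ i)
  P₃ = λ i → sel (does (σ i ≟ᶠ _)) (e₃ i)

endsAt↭incidentEdges : ∀ {n} (w : Vtx (suc n)) → endsAt w ↭ incidentEdges w
endsAt↭incidentEdges w@(a j) = ↭-trans (↭-reflexive (endsAt-blocks w))
  (↭-trans (concatMap-↭ (block-a j) (allFin _)) (gather ab ac ad id id refl))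
endsAt↭incidentEdges w@(b j) = ↭-trans (↭-reflexive (endsAt-blocks w))
  (↭-trans (concatMap-↭ (block-b j) (allFin _)) (gather ab bb bb nxt nxt≡⇒≡prev (nxt-prev j)))
endsAt↭incidentEdges w@(c j) = ↭-trans (↭-reflexive (endsAt-blocks w))
  (↭-trans (concatMap-↭ (block-c j) (allFin _))
    (gather ac cc (λ i → if isLast i then dd i else cc i) nxt nxt≡⇒≡prev (nxt-prev j)))
endsAt↭incidentEdges w@(d j) = ↭-trans (↭-reflexive (endsAt-blocks w))
  (↭-trans (concatMap-↭ (block-d j) (allFin _))
    (gather ad dd (λ i → if isLast i then cc i else dd i) nxt nxt≡⇒≡prev (nxt-prev j)))

across : ∀ {k} → Fin k → Triple → Triple
across i = if isLast i then twist else id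

-- A cyclic sequence of k = suc n slices, the rail state leaving slice i entering slice
-- i + 1, crossed when going from slice k - 1 to slice 0.
record Ring (n : ℕ) : Set where
  field
    slice : Fin (suc n) → Slice
    input : Fin (suc n) → Triple
    valid : ∀ i → T (sliceOK (removed (slice i)) (input i) (spokes (slice i)) (output (slice i)))
    link  : ∀ i → input (nxt i) ≡ across i (output (slice i))

sumZ-colours : ∀ {A : Set} (φ : A → 𝕂) {xs ys U} → xs ↭ ys → map φ ys ≡ toList U →
               sumZ (map (ι ∘ φ) xs) ≡ total U
sumZ-colours φ {xs} {ys} {U} xs↭ys φ-ys = begin
  sumZ (map (ι ∘ φ) xs)      ≡⟨ sumZ-↭ (map⁺ (ι ∘ φ) xs↭ys) ⟩
  sumZ (map (ι ∘ φ) ys)      ≡⟨ cong sumZ (map-∘ {g = ι} {φ} ys) ⟩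
  sumZ (map ι (map φ ys))    ≡⟨ cong (sumZ ∘ map ι) φ-ys ⟩
  total U                    ∎
  where open ≡-Reasoning

toList-! : ∀ t → toList t ≡ t ! p₁ ∷ t ! p₂ ∷ t ! p₃ ∷ []
toList-! (tri _ _ _) = refl

star-b : ∀ x s y → star kb x s y ≡ tri (s ! p₁) (y ! p₁) (x ! p₁)
star-b (tri _ _ _) (tri _ _ _) (tri _ _ _) = refl

star-c : ∀ x s y → star kc x s y ≡ tri (s ! p₂) (y ! p₂) (x ! p₂)
star-c (tri _ _ _) (tri _ _ _) (tri _ _ _) = refl

star-d : ∀ x s y → star kd x s y ≡ tri (s ! p₃) (y ! p₃) (x ! p₃)
star-d (tri _ _ _) (tri _ _ _) (tri _ _ _) = refl

across-p₁ : ∀ β t → (if β then twist else id) t ! p₁ ≡ t ! p₁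
across-p₁ true  (tri _ _ _) = refl
across-p₁ false (tri _ _ _) = refl

across-p₂ : ∀ β t → (if β then twist else id) t ! p₂ ≡ (if β then t ! p₃ else t ! p₂)
across-p₂ true  (tri _ _ _) = refl
across-p₂ false (tri _ _ _) = refl

across-p₃ : ∀ β t → (if β then twist else id) t ! p₃ ≡ (if β then t ! p₂ else t ! p₃)
across-p₃ true  (tri _ _ _) = refl
across-p₃ false (tri _ _ _) = refl

module _ {n} (R : Ring n) where
  open Ring R

  ringColouring : Edge (suc n) → 𝕂
  ringColouring (ab i) = spokes (slice i) ! p₁
  ringColouring (ac i) = spokes (slice i) ! p₂
  ringColouring (ad i) = spokes (slice i) ! p₃
  ringColouring (bb i) = output (slice i) ! p₁
  ringColouring (cc i) = output (slice i) ! p₂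
  ringColouring (dd i) = output (slice i) ! p₃

  starAt : Vtx (suc n) → Triple
  starAt w = star (kind w) (input (slot w)) (spokes (slice (slot w))) (output (slice (slot w)))

  private
    φ = ringColouring

    entering : ∀ j → input j ≡ across (prev j) (output (slice (prev j)))
    entering j = trans (cong input (sym (nxt-prev j))) (link (prev j))

  incidentColours : ∀ w → map φ (incidentEdges w) ≡ toList (starAt w)
  incidentColours (a j) = sym (toList-! (spokes (slice j)))
  incidentColours (b j) = begin
    φ (ab j) ∷ φ (bb j) ∷ φ (bb (prev j)) ∷ []             ≡⟨ cong (λ x → φ (ab j) ∷ φ (bb j) ∷ x ∷ []) (begin
      output (slice (prev j)) ! p₁                           ≡⟨ across-p₁ (isLast (prev j)) _ ⟨
      across (prev j) (output (slice (prev j))) ! p₁         ≡⟨ cong (_! p₁) (entering j) ⟨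
      input j ! p₁                                           ∎) ⟩
    φ (ab j) ∷ φ (bb j) ∷ input j ! p₁ ∷ []                 ≡⟨ cong toList (star-b (input j) _ _) ⟨
    toList (starAt (b j))                                    ∎
    where open ≡-Reasoning
  incidentColours (c j) = begin
    φ (ac j) ∷ φ (cc j) ∷ φ (cEntering j) ∷ []             ≡⟨ cong (λ x → φ (ac j) ∷ φ (cc j) ∷ x ∷ []) (begin
      φ (cEntering j)                                        ≡⟨ if-float φ (isLast (prev j)) ⟩
      (if isLast (prev j) then output (slice (prev j)) ! p₃
       else output (slice (prev j)) ! p₂)                    ≡⟨ across-p₂ (isLast (prev j)) _ ⟨
      across (prev j) (output (slice (prev j))) ! p₂         ≡⟨ cong (_! p₂) (entering j) ⟨
      input j ! p₂                                           ∎) ⟩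
    φ (ac j) ∷ φ (cc j) ∷ input j ! p₂ ∷ []                 ≡⟨ cong toList (star-c (input j) _ _) ⟨
    toList (starAt (c j))                                    ∎
    where open ≡-Reasoning
  incidentColours (d j) = begin
    φ (ad j) ∷ φ (dd j) ∷ φ (dEntering j) ∷ []             ≡⟨ cong (λ x → φ (ad j) ∷ φ (dd j) ∷ x ∷ []) (begin
      φ (dEntering j)                                        ≡⟨ if-float φ (isLast (prev j)) ⟩
      (if isLast (prev j) then output (slice (prev j)) ! p₂
       else output (slice (prev j)) ! p₃)                    ≡⟨ across-p₃ (isLast (prev j)) _ ⟨
      across (prev j) (output (slice (prev j))) ! p₃         ≡⟨ cong (_! p₃) (entering j) ⟨
      input j ! p₃                                           ∎) ⟩
    φ (ad j) ∷ φ (dd j) ∷ input j ! p₃ ∷ []                 ≡⟨ cong toList (star-d (input j) _ _) ⟨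
    toList (starAt (d j))                                    ∎
    where open ≡-Reasoning

  ringColouring-isColouring : (u v : Vtx (suc n)) →
    (∀ i κ → removed (slice i) ≡ just κ → vertex κ i ≡ u ⊎ vertex κ i ≡ v) →
    IsColouring-J-minus u v φ
  ringColouring-isColouring u v broken w w≢u w≢v =
    trans (sumZ-colours φ (endsAt↭incidentEdges w) (incidentColours w))
          (sliceOK-balanced (kind w) (valid (slot w)) intact)
    where
    intact : removed (slice (slot w)) ≢ just (kind w)
    intact eq with broken (slot w) (kind w) eq
    ... | inj₁ w≡u = w≢u (trans (sym (vertex-kind-slot w)) w≡u)
    ... | inj₂ w≡v = w≢v (trans (sym (vertex-kind-slot w)) w≡v)

-- Out of range, sliceAt gives an intact junk slice and stateAt the initial state.
sliceAt : List Slice → ℕ → Slice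
sliceAt []       _       = mkSlice nothing (tri κ₁ κ₁ κ₁) (tri κ₁ κ₁ κ₁)
sliceAt (σ ∷ _)  zero    = σ
sliceAt (_ ∷ σs) (suc m) = sliceAt σs m

stateAt : Triple → List Slice → ℕ → Triple
stateAt x []       _       = x
stateAt x (_ ∷ _)  zero    = x
stateAt x (σ ∷ σs) (suc m) = stateAt (output σ) σs m

stateAt-zero : ∀ x σs → stateAt x σs 0 ≡ x
stateAt-zero x []      = refl
stateAt-zero x (_ ∷ _) = refl

stateAt-suc : ∀ x σs {m} → m < length σs → stateAt x σs (suc m) ≡ output (sliceAt σs m)
stateAt-suc x (σ ∷ σs) {zero}  _         = stateAt-zero (output σ) σs
stateAt-suc x (σ ∷ σs) {suc m} (s≤s m<ℓ) = stateAt-suc (output σ) σs m<ℓ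

Run-sliceOK : ∀ {x y} σs {m} → Run x σs y → m < length σs →
  T (sliceOK (removed (sliceAt σs m)) (stateAt x σs m) (spokes (sliceAt σs m)) (output (sliceAt σs m)))
Run-sliceOK (mkSlice _ _ _ ∷ σs) {zero}  (ok , _) _         = ok
Run-sliceOK (mkSlice _ _ _ ∷ σs) {suc m} (_ , ρ)  (s≤s m<ℓ) = Run-sliceOK σs ρ m<ℓ

Run-end : ∀ {x y} σs {m} → Run x σs y → length σs ≡ suc m → output (sliceAt σs m) ≡ y
Run-end (mkSlice _ _ _ ∷ [])         {zero}  (_ , refl) _  = refl
Run-end (mkSlice _ _ z ∷ σs@(_ ∷ _)) {suc m} (_ , ρ)    eq = Run-end {z} σs ρ (suc-injective eq)

sliceAt-++ : ∀ σs {τs} m → sliceAt (σs ++ τs) (length σs + m) ≡ sliceAt τs m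
sliceAt-++ []       m = refl
sliceAt-++ (_ ∷ σs) m = sliceAt-++ σs m

stateAt-++ : ∀ {x y} σs {τs} m → Run x σs y → stateAt x (σs ++ τs) (length σs + m) ≡ stateAt y τs m
stateAt-++ []                   m refl    = refl
stateAt-++ (mkSlice _ _ _ ∷ σs) m (_ , ρ) = stateAt-++ σs m ρ

removed-intact : ∀ σs {m κ} → All Intact σs → removed (sliceAt σs m) ≢ just κ
removed-intact []       []                  ()
removed-intact (_ ∷ _)  {zero}  (intact ∷ _) eq = contradiction (trans (sym intact) eq) λ ()
removed-intact (_ ∷ σs) {suc m} (_ ∷ intacts) = removed-intact σs intacts

removed-++ : ∀ σs {σ τs m κ} → All Intact σs → removed (sliceAt (σs ++ σ ∷ τs) m) ≡ just κ →
             m ≡ length σs × removed σ ≡ just κ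
             ⊎ ∃[ m′ ] m ≡ suc (length σs + m′) × removed (sliceAt τs m′) ≡ just κ
removed-++ []       {m = zero}  []             eq = inj₁ (refl , eq)
removed-++ []       {m = suc m} []             eq = inj₂ (m , refl , eq)
removed-++ (_ ∷ _)  {m = zero}  (intact ∷ _)   eq = contradiction (trans (sym intact) eq) λ ()
removed-++ (_ ∷ σs) {m = suc m} (_ ∷ intacts) eq with removed-++ σs intacts eq
... | inj₁ (m≡ , r)      = inj₁ (cong suc m≡ , r)
... | inj₂ (m′ , m≡ , r) = inj₂ (m′ , cong suc m≡ , r)

ringOf : ∀ {n} (σs : List Slice) (e : Triple) → Run (twist e) σs e → length σs ≡ suc n → Ring n
ringOf {n} σs e ρ len = record
  { slice = λ i → sliceAt σs (toℕ i)
  ; input = λ i → stateAt (twist e) σs (toℕ i)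
  ; valid = λ i → Run-sliceOK σs ρ (in-range i)
  ; link  = link
  }
  where
  in-range : ∀ (i : Fin (suc n)) → toℕ i < length σs
  in-range i = subst (toℕ i <_) (sym len) (toℕ<n i)

  link : ∀ i → stateAt (twist e) σs (toℕ (nxt i)) ≡ across i (output (sliceAt σs (toℕ i)))
  link i with nextView i
  ... | inner _ toℕ-nxt last≡false = begin
    stateAt (twist e) σs (toℕ (nxt i))      ≡⟨ cong (stateAt (twist e) σs) toℕ-nxt ⟩
    stateAt (twist e) σs (suc (toℕ i))      ≡⟨ stateAt-suc (twist e) σs (in-range i) ⟩
    output (sliceAt σs (toℕ i))             ≡⟨ cong (λ β → (if β then twist else id) y) last≡false ⟨
    across i (output (sliceAt σs (toℕ i)))  ∎
    where
    open ≡-Reasoning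
    y = output (sliceAt σs (toℕ i))
  ... | last i≡n nxt≡0 last≡true = begin
    stateAt (twist e) σs (toℕ (nxt i))      ≡⟨ cong (stateAt (twist e) σs ∘ toℕ) nxt≡0 ⟩
    stateAt (twist e) σs 0                  ≡⟨ stateAt-zero (twist e) σs ⟩
    twist e                                 ≡⟨ cong twist (Run-end σs ρ (trans len (cong suc (sym i≡n)))) ⟨
    twist (output (sliceAt σs (toℕ i)))     ≡⟨ cong (λ β → (if β then twist else id) y) last≡true ⟨
    across i (output (sliceAt σs (toℕ i)))  ∎
    where
    open ≡-Reasoning
    y = output (sliceAt σs (toℕ i))

record Assembly (n p q : ℕ) (κᵃ κᵇ : Kind) (x₁ s₁ y₁ x₂ s₂ y₂ : Triple) : Set where
  field
    ring   : Ring n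
    first  : ∀ i → toℕ i ≡ p → Ring.slice ring i ≡ mkSlice (just κᵃ) s₁ y₁ × Ring.input ring i ≡ x₁
    second : ∀ i → toℕ i ≡ p + suc q → Ring.slice ring i ≡ mkSlice (just κᵇ) s₂ y₂ × Ring.input ring i ≡ x₂
    broken : ∀ i κ → removed (Ring.slice ring i) ≡ just κ →
             toℕ i ≡ p × κᵃ ≡ κ ⊎ toℕ i ≡ p + suc q × κᵇ ≡ κ

Walk-split : ∀ r {p x z} → Walk (r + p) x z → ∃[ y ] Walk r x y × Walk p y z
Walk-split r {p} {x} {z} (walk ωs len intact ρ) =
  proj₁ split , walk C lenC (Allₚ.++⁻ˡ C intact′) (proj₁ (proj₂ split))
              , walk A lenA (Allₚ.++⁻ʳ C intact′) (proj₂ (proj₂ split))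
  where
  C = take r ωs
  A = drop r ωs
  ωs≡ : C ++ A ≡ ωs
  ωs≡ = take++drop≡id r ωs
  lenC : length C ≡ r
  lenC = trans (length-take r ωs) (trans (cong (r ⊓_) len) (m≤n⇒m⊓n≡m (m≤m+n r p)))
  lenA : length A ≡ p
  lenA = trans (length-drop r ωs) (trans (cong (_∸ r) len) (m+n∸m≡n r p))
  split = Run-split C (subst (λ ωs → Run x ωs z) (sym ωs≡) ρ)
  intact′ = subst (All Intact) (sym ωs≡) intact

Walk-twist : ∀ {L x y} → Walk L x y → Walk L (twist x) (twist y)
Walk-twist (walk σs len intact ρ) =
  walk (map twistSlice σs) (trans (length-map twistSlice σs) len) (Allₚ.map⁺ intact) (Run-twist intact ρ)

assemble : ∀ {n} p q r → p + suc (q + suc r) ≡ suc n → ∀ {κᵃ κᵇ x₁ s₁ y₁ x₂ s₂ y₂ m} →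
           T (sliceOK (just κᵃ) x₁ s₁ y₁) → T (sliceOK (just κᵇ) x₂ s₂ y₂) →
           Walk p (twist m) x₁ → Walk q y₁ x₂ → Walk r y₂ m → Assembly n p q κᵃ κᵇ x₁ s₁ y₁ x₂ s₂ y₂
assemble {n} p q r len {κᵃ} {κᵇ} {x₁} {s₁} {y₁} {x₂} {s₂} {y₂} {m} ok₁ ok₂
         (walk αs lenα intactα ρα) (walk βs lenβ intactβ ρβ) (walk γs lenγ intactγ ργ) = record
  { ring   = ringOf σs m ρ lenσs
  ; first  = λ i i≡ → trans (cong (sliceAt σs) (trans i≡ at₁)) (sliceAt-++ αs 0)
                     , trans (cong (stateAt (twist m) σs) (trans i≡ at₁)) (stateAt-++ αs 0 ρα)
  ; second = λ i i≡ → trans (cong (sliceAt σs) (trans i≡ at₂)) slice₂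
                     , trans (cong (stateAt (twist m) σs) (trans i≡ at₂)) input₂
  ; broken = broken
  }
  where
  σs = αs ++ mkSlice (just κᵃ) s₁ y₁ ∷ βs ++ mkSlice (just κᵇ) s₂ y₂ ∷ γs
  ρ : Run (twist m) σs m
  ρ = Run-++ αs ρα (ok₁ , Run-++ βs ρβ (ok₂ , ργ))
  lenσs : length σs ≡ suc n
  lenσs = trans (length-++ αs) (trans (cong₂ _+_ lenα (cong suc (trans (length-++ βs)
            (cong₂ _+_ lenβ (cong suc lenγ))))) len)
  at₁ : p ≡ length αs + 0
  at₁ = sym (trans (+-identityʳ (length αs)) lenα)
  at₂ : p + suc q ≡ length αs + suc (length βs + 0)
  at₂ = sym (cong₂ (λ x y → x + suc y) lenα (trans (+-identityʳ (length βs)) lenβ))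
  slice₂ : sliceAt σs (length αs + suc (length βs + 0)) ≡ mkSlice (just κᵇ) s₂ y₂
  slice₂ = trans (sliceAt-++ αs (suc (length βs + 0))) (sliceAt-++ βs 0)
  input₂ : stateAt (twist m) σs (length αs + suc (length βs + 0)) ≡ x₂
  input₂ = trans (stateAt-++ αs (suc (length βs + 0)) ρα) (stateAt-++ βs 0 ρβ)
  broken : ∀ i κ → removed (sliceAt σs (toℕ i)) ≡ just κ →
           toℕ i ≡ p × κᵃ ≡ κ ⊎ toℕ i ≡ p + suc q × κᵇ ≡ κ
  broken i κ eq with removed-++ αs intactα eq
  ... | inj₁ (i≡ , r) = inj₁ (trans i≡ lenα , Maybe.just-injective r)
  ... | inj₂ (m′ , i≡ , r) with removed-++ βs intactβ r
  ...   | inj₁ (m′≡ , r′) =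
          inj₂ (trans i≡ (trans (cong₂ (λ x y → suc (x + y)) lenα (trans m′≡ lenβ)) (sym (+-suc p q)))
               , Maybe.just-injective r′)
  ...   | inj₂ (_ , _ , r′) = contradiction r′ (removed-intact γs intactγ)

record Placed {n} (w₁ w₂ : Vtx (suc n)) (p q r : ℕ) : Set where
  field
    at₁  : toℕ (slot w₁) ≡ p
    at₂  : toℕ (slot w₂) ≡ p + suc q
    size : p + suc (q + suc r) ≡ suc n

colouring-from-slices :
  ∀ {n} {w₁ w₂ : Vtx (suc n)} {p q r} → Placed w₁ w₂ p q r → ∀ {x₁ s₁ y₁ x₂ s₂ y₂} →
  T (sliceOK (just (kind w₁)) x₁ s₁ y₁) → T (sliceOK (just (kind w₂)) x₂ s₂ y₂) →
  T (linked (gapOf q) y₁ x₂) → T (linked (gapOf (r + p)) y₂ (twist x₁)) →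
  ∃[ φ ] IsColouring-J-minus w₁ w₂ φ
         × map φ (incidentEdges w₁) ≡ toList (star (kind w₁) x₁ s₁ y₁)
         × map φ (incidentEdges w₂) ≡ toList (star (kind w₂) x₂ s₂ y₂)
colouring-from-slices {w₁ = w₁} {w₂} {p} {q} {r} placed {x₁} {s₁} {y₁} {x₂} {s₂} {y₂} ok₁ ok₂ link₁₂ link₂₁ =
  ringColouring R , ringColouring-isColouring R w₁ w₂ broken′ , colours w₁ (first (slot w₁) at₁)
  , colours w₂ (second (slot w₂) at₂)
  where
  open Placed placed
  -- The run from w₂ round to w₁ is cut at the crossing; its last p slices, twisted, become
  -- slices 0, …, p - 1.
  cut = Walk-split r (walkOf (r + p) y₂ (twist x₁) link₂₁)
  open Assembly (assemble p q r size {kind w₁} {kind w₂} {x₁} {s₁} {y₁} {x₂} {s₂} {y₂} ok₁ ok₂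
                   (subst (Walk p (twist (proj₁ cut))) (twist-involutive x₁) (Walk-twist (proj₂ (proj₂ cut))))
                   (walkOf q y₁ x₂ link₁₂) (proj₁ (proj₂ cut)))
  R = ring
  colours : ∀ w {x s y} → Ring.slice R (slot w) ≡ mkSlice (just (kind w)) s y × Ring.input R (slot w) ≡ x →
            map (ringColouring R) (incidentEdges w) ≡ toList (star (kind w) x s y)
  colours w (slice≡ , input≡) = trans (incidentColours R w)
    (cong₂ (λ σ x → toList (star (kind w) x (spokes σ) (output σ))) slice≡ input≡)
  broken′ : ∀ i κ → removed (Ring.slice R i) ≡ just κ → vertex κ i ≡ w₁ ⊎ vertex κ i ≡ w₂
  broken′ i κ eq with broken i κ eq
  ... | inj₁ (i≡ , κ≡) =
    inj₁ (trans (cong₂ vertex (sym κ≡) (toℕ-injective (trans i≡ (sym at₁)))) (vertex-kind-slot w₁))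
  ... | inj₂ (i≡ , κ≡) =
    inj₂ (trans (cong₂ vertex (sym κ≡) (toℕ-injective (trans i≡ (sym at₂)))) (vertex-kind-slot w₂))

edge-adj : ∀ {k} (e : Edge k) → Adj (proj₁ (ends e)) (proj₂ (ends e))
edge-adj e = e , inj₁ refl

Adj-sym : ∀ {k} {x y : Vtx k} → Adj x y → Adj y x
Adj-sym (e , inj₁ eq) = e , inj₂ eq
Adj-sym (e , inj₂ eq) = e , inj₁ eq

Dist≥3-sym : ∀ {k} {x y : Vtx k} → Dist≥3 x y → Dist≥3 y x
Dist≥3-sym (x≢y , ¬adj , ¬path) =
  x≢y ∘ sym , ¬adj ∘ Adj-sym , λ (w , x~w , w~y) → ¬path (w , Adj-sym w~y , Adj-sym x~w)

adjacent-close : ∀ {k} {x y : Vtx k} → Adj x y → ¬ Dist≥3 x y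
adjacent-close x~y (_ , ¬adj , _) = ¬adj x~y

two-steps-close : ∀ {k} {x y z : Vtx k} → Adj x y → Adj y z → ¬ Dist≥3 x z
two-steps-close {y = y} x~y y~z (_ , _ , ¬path) = ¬path (y , x~y , y~z)

module _ {k} {i i′ : Fin k} where
  bb-adj : nxt i ≡ i′ → Adj (b i) (b i′)
  bb-adj refl = edge-adj (bb i)

  cc-adj : ∀ {β} → nxt i ≡ i′ → isLast i ≡ β → Adj (c i) (if β then d i′ else c i′)
  cc-adj refl refl = edge-adj (cc i)

  dd-adj : ∀ {β} → nxt i ≡ i′ → isLast i ≡ β → Adj (d i) (if β then c i′ else d i′)
  dd-adj refl refl = edge-adj (dd i)

  close-next : ∀ crossed → nxt i ≡ i′ → isLast i ≡ crossed →
               All (λ (κ , κ′) → ¬ Dist≥3 (vertex κ i) (vertex κ′ i′)) (nearPairs g₀ crossed)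
  close-next false hop cross =
      two-steps-close (edge-adj (ab i)) (bb-adj hop)
    ∷ two-steps-close (edge-adj (ac i)) (cc-adj hop cross)
    ∷ two-steps-close (edge-adj (ad i)) (dd-adj hop cross)
    ∷ two-steps-close (bb-adj hop) (Adj-sym (edge-adj (ab i′)))
    ∷ adjacent-close (bb-adj hop)
    ∷ two-steps-close (cc-adj hop cross) (Adj-sym (edge-adj (ac i′)))
    ∷ adjacent-close (cc-adj hop cross)
    ∷ two-steps-close (dd-adj hop cross) (Adj-sym (edge-adj (ad i′)))
    ∷ adjacent-close (dd-adj hop cross)
    ∷ []
  close-next true hop cross =
      two-steps-close (edge-adj (ab i)) (bb-adj hop)
    ∷ two-steps-close (edge-adj (ad i)) (dd-adj hop cross)
    ∷ two-steps-close (edge-adj (ac i)) (cc-adj hop cross)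
    ∷ two-steps-close (bb-adj hop) (Adj-sym (edge-adj (ab i′)))
    ∷ adjacent-close (bb-adj hop)
    ∷ two-steps-close (cc-adj hop cross) (Adj-sym (edge-adj (ad i′)))
    ∷ adjacent-close (cc-adj hop cross)
    ∷ two-steps-close (dd-adj hop cross) (Adj-sym (edge-adj (ac i′)))
    ∷ adjacent-close (dd-adj hop cross)
    ∷ []

-- In two steps the c- and d-rails are exchanged iff exactly one step crosses.
close-next-but-one : ∀ {k} {i m i″ : Fin k} ℓ₁ ℓ₂ → nxt i ≡ m → nxt m ≡ i″ → isLast i ≡ ℓ₁ → isLast m ≡ ℓ₂ →
  All (λ (κ , κ′) → ¬ Dist≥3 (vertex κ i) (vertex κ′ i″)) (nearPairs g₁ (ℓ₁ xor ℓ₂))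
close-next-but-one false false hop hop′ cross cross′ =
    two-steps-close (bb-adj hop) (bb-adj hop′)
  ∷ two-steps-close (cc-adj hop cross) (cc-adj hop′ cross′)
  ∷ two-steps-close (dd-adj hop cross) (dd-adj hop′ cross′)
  ∷ []
close-next-but-one true true hop hop′ cross cross′ =
    two-steps-close (bb-adj hop) (bb-adj hop′)
  ∷ two-steps-close (cc-adj hop cross) (dd-adj hop′ cross′)
  ∷ two-steps-close (dd-adj hop cross) (cc-adj hop′ cross′)
  ∷ []
close-next-but-one false true hop hop′ cross cross′ =
    two-steps-close (bb-adj hop) (bb-adj hop′)
  ∷ two-steps-close (cc-adj hop cross) (cc-adj hop′ cross′)
  ∷ two-steps-close (dd-adj hop cross) (dd-adj hop′ cross′)
  ∷ []
close-next-but-one true false hop hop′ cross cross′ =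
    two-steps-close (bb-adj hop) (bb-adj hop′)
  ∷ two-steps-close (cc-adj hop cross) (dd-adj hop′ cross′)
  ∷ two-steps-close (dd-adj hop cross) (cc-adj hop′ cross′)
  ∷ []

close-same : ∀ {k} (i : Fin k) κ κ′ → ¬ Dist≥3 (vertex κ i) (vertex κ′ i)
close-same i ka ka (≢ , _) = ≢ refl
close-same i kb kb (≢ , _) = ≢ refl
close-same i kc kc (≢ , _) = ≢ refl
close-same i kd kd (≢ , _) = ≢ refl
close-same i ka kb = adjacent-close (edge-adj (ab i))
close-same i ka kc = adjacent-close (edge-adj (ac i))
close-same i ka kd = adjacent-close (edge-adj (ad i))
close-same i kb ka = adjacent-close (Adj-sym (edge-adj (ab i)))
close-same i kc ka = adjacent-close (Adj-sym (edge-adj (ac i)))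
close-same i kd ka = adjacent-close (Adj-sym (edge-adj (ad i)))
close-same i kb kc = two-steps-close (Adj-sym (edge-adj (ab i))) (edge-adj (ac i))
close-same i kb kd = two-steps-close (Adj-sym (edge-adj (ab i))) (edge-adj (ad i))
close-same i kc kb = two-steps-close (Adj-sym (edge-adj (ac i))) (edge-adj (ab i))
close-same i kc kd = two-steps-close (Adj-sym (edge-adj (ac i))) (edge-adj (ad i))
close-same i kd kb = two-steps-close (Adj-sym (edge-adj (ad i))) (edge-adj (ab i))
close-same i kd kc = two-steps-close (Adj-sym (edge-adj (ad i))) (edge-adj (ac i))

near-member : ∀ g crossed κ κ′ → T (near g crossed κ κ′) → (κ , κ′) ∈ nearPairs g crossed
near-member g crossed κ κ′ = toWitness {a? = any? (Product.≡-dec _≟ᵏ_ _≟ᵏ_ (κ , κ′)) (nearPairs g crossed)}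

Placed-end : ∀ {n} {w₁ w₂ : Vtx (suc n)} {p q r} → Placed w₁ w₂ p q r → toℕ (slot w₂) + r ≡ n
Placed-end {n} {w₂ = w₂} {p} {q} {r} placed = suc-injective (begin
  suc (toℕ (slot w₂) + r)  ≡⟨ cong (λ x → suc (x + r)) at₂ ⟩
  suc (p + suc q + r)      ≡⟨ cong suc (+-assoc p (suc q) r) ⟩
  suc (p + suc (q + r))    ≡⟨ +-suc p (suc (q + r)) ⟨
  p + suc (suc (q + r))    ≡⟨ cong (λ x → p + suc x) (+-suc q r) ⟨
  p + suc (q + suc r)      ≡⟨ size ⟩
  suc n                    ∎)
  where
  open Placed placed
  open ≡-Reasoning

close-at : ∀ {k} {w₁ w₂ : Vtx k} → ¬ Dist≥3 (vertex (kind w₁) (slot w₁)) (vertex (kind w₂) (slot w₂)) →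
           ¬ Dist≥3 w₁ w₂
close-at {w₁ = w₁} {w₂} = subst₂ (λ x y → ¬ Dist≥3 x y) (vertex-kind-slot w₁) (vertex-kind-slot w₂)

+≡1 : ∀ m n → m + n ≡ 1 → m ≡ 0 × n ≡ 1 ⊎ m ≡ 1 × n ≡ 0
+≡1 zero          n eq = inj₁ (refl , eq)
+≡1 (suc zero)    n eq = inj₂ (refl , suc-injective eq)
+≡1 (suc (suc m)) n ()

w₂≡2+w₁ : ∀ {n} {w₁ w₂ : Vtx (suc n)} {p q r} → Placed w₁ w₂ p q r → gapOf q ≡ g₁ →
          toℕ (slot w₂) ≡ suc (suc (toℕ (slot w₁)))
w₂≡2+w₁ {w₁ = w₁} {w₂} {p} {q} placed eq = begin
  toℕ (slot w₂)   ≡⟨ at₂ ⟩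
  p + suc q       ≡⟨ cong (λ q → p + suc q) (gapOf≡g₁ q eq) ⟩
  p + 2           ≡⟨ +-comm p 2 ⟩
  suc (suc p)     ≡⟨ cong (λ m → suc (suc m)) at₁ ⟨
  suc (suc (toℕ (slot w₁))) ∎
  where
  open Placed placed
  open ≡-Reasoning

close-ahead : ∀ {n} {w₁ w₂ : Vtx (suc n)} {p q r} → Placed w₁ w₂ p q r →
              T (near (gapOf q) false (kind w₁) (kind w₂)) → ¬ Dist≥3 w₁ w₂
close-ahead {n} {w₁} {w₂} {p} {q} placed h with gapOf q in eq
... | g₀ = close-at (All.lookup (close-next false hop cross) (near-member g₀ false (kind w₁) (kind w₂) h))
  where
  open Placed placed
  hop-cross = nxt-of-suc (begin
    toℕ (slot w₂)   ≡⟨ at₂ ⟩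
    p + suc q       ≡⟨ cong (λ q → p + suc q) (gapOf≡g₀ q eq) ⟩
    p + 1           ≡⟨ +-comm p 1 ⟩
    suc p           ≡⟨ cong suc at₁ ⟨
    suc (toℕ (slot w₁)) ∎)
    where open ≡-Reasoning
  hop = proj₁ hop-cross
  cross = proj₂ hop-cross
... | gₑ = ⊥-elim h
... | gₒ = ⊥-elim h
... | g₁ with nextView (slot w₁)
...   | last w₁≡n _ _ =
  contradiction (subst (_< suc n) (trans (w₂≡2+w₁ placed eq) (cong (λ m → suc (suc m)) w₁≡n)) (toℕ<n (slot w₂)))
                (≤⇒≯ (n≤1+n (suc n)))
...   | inner _ toℕ-nxt cross =
  close-at (All.lookup (close-next-but-one false false refl hop′ cross cross′)
                        (near-member g₁ false (kind w₁) (kind w₂) h))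
  where
  hop-cross′ = nxt-of-suc {i = nxt (slot w₁)} {slot w₂} (trans (w₂≡2+w₁ placed eq) (cong suc (sym toℕ-nxt)))
  hop′ = proj₁ hop-cross′
  cross′ = proj₂ hop-cross′

close-behind : ∀ {n} {w₁ w₂ : Vtx (suc n)} {p q r} → Placed w₁ w₂ p q r →
               T (near (gapOf (r + p)) true (kind w₂) (kind w₁)) → ¬ Dist≥3 w₂ w₁
close-behind {n} {w₁} {w₂} {p} {q} {r} placed h with gapOf (r + p) in eq
... | gₑ = ⊥-elim h
... | gₒ = ⊥-elim h
... | g₀ = close-at (All.lookup (close-next true (proj₁ hop-cross) (proj₂ hop-cross))
                                (near-member g₀ true (kind w₂) (kind w₁) h))
  where
  open Placed placed
  w₂-last : toℕ (slot w₂) ≡ n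
  w₂-last = trans (sym (trans (cong (toℕ (slot w₂) +_) (m+n≡0⇒m≡0 r (gapOf≡g₀ (r + p) eq))) (+-identityʳ _)))
                  (Placed-end placed)
  hop-cross = nxt-of-last w₂-last (trans at₁ (m+n≡0⇒n≡0 r (gapOf≡g₀ (r + p) eq)))
... | g₁ with +≡1 r p (gapOf≡g₁ (r + p) eq)
...   | inj₁ (r≡0 , p≡1) =
  close-at (All.lookup (close-next-but-one true false (proj₁ hop-cross) (proj₁ hop-cross′)
                                           (proj₂ hop-cross) (proj₂ hop-cross′))
                       (near-member g₁ true (kind w₂) (kind w₁) h))
  where
  open Placed placed
  hop-cross  = nxt-of-last {i = slot w₂} {zero}
                 (trans (sym (trans (cong (toℕ (slot w₂) +_) r≡0) (+-identityʳ _))) (Placed-end placed)) refl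
  hop-cross′ = nxt-of-suc {i = zero} {slot w₁} (trans at₁ p≡1)
...   | inj₂ (r≡1 , p≡0) with nextView (slot w₂)
...     | last w₂≡n _ _ = contradiction (begin
  suc n                   ≡⟨ cong suc w₂≡n ⟨
  suc (toℕ (slot w₂))     ≡⟨ +-comm 1 (toℕ (slot w₂)) ⟩
  toℕ (slot w₂) + 1       ≡⟨ cong (toℕ (slot w₂) +_) r≡1 ⟨
  toℕ (slot w₂) + r       ≡⟨ Placed-end placed ⟩
  n                       ∎) 1+n≢n
  where open ≡-Reasoning
...     | inner _ toℕ-nxt cross =
  close-at (All.lookup (close-next-but-one false true refl (proj₁ hop-cross′) cross (proj₂ hop-cross′))
                       (near-member g₁ true (kind w₂) (kind w₁) h))
  where
  open Placed placed
  hop-cross′ = nxt-of-last {i = nxt (slot w₂)} {slot w₁}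
    (trans toℕ-nxt (trans (+-comm 1 _) (trans (cong (toℕ (slot w₂) +_) (sym r≡1)) (Placed-end placed))))
    (trans at₁ p≡0)

separated : ∀ {n} {w₁ w₂ : Vtx (suc n)} {p q r} → Placed w₁ w₂ p q r → Dist≥3 w₁ w₂ →
            T (not (near (gapOf q) false (kind w₁) (kind w₂) ∨ near (gapOf (r + p)) true (kind w₂) (kind w₁)))
separated {w₁ = w₁} {w₂} {p} {q} {r} placed far
  with near (gapOf q) false (kind w₁) (kind w₂) in ahead | near (gapOf (r + p)) true (kind w₂) (kind w₁) in behind
... | false | false = tt
... | true  | _     = close-ahead placed (subst T (sym ahead) tt) far
... | false | true  = close-behind placed (subst T (sym behind) tt) (Dist≥3-sym far)

record Extension {k} (u v : Vtx k) (V : Triple) (α : 𝕂) (j : Pos) : Set where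
  field
    φ          : Edge k → 𝕂
    colouring  : IsColouring-J-minus u v φ
    U          : Triple
    φ-at-u     : map φ (incidentEdges u) ≡ toList U
    φ-at-v     : map φ (incidentEdges v) ≡ toList V
    U-at-j     : U ! j ≡ α
    U-total    : total U ≡ total V

extend : (𝕂 → 𝕂) → Z2² → Z2²
extend f (false , false) = 0Z
extend f (false , true)  = ι (f κ₁)
extend f (true  , false) = ι (f κ₂)
extend f (true  , true)  = ι (f κ₃)

Additive : (𝕂 → 𝕂) → Set
Additive f = ∀ x z → extend f (ι x ⊕ z) ≡ ι (f x) ⊕ extend f z

sumZ-extend : ∀ {f} → Additive f → ∀ xs → sumZ (map (ι ∘ f) xs) ≡ extend f (sumZ (map ι xs))
sumZ-extend     add []       = refl
sumZ-extend {f} add (x ∷ xs) = trans (cong (ι (f x) ⊕_) (sumZ-extend add xs)) (sym (add x (sumZ (map ι xs))))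

toList-mapTriple : ∀ f t → toList (mapTriple f t) ≡ map f (toList t)
toList-mapTriple f (tri _ _ _) = refl

total-mapTriple : ∀ {f} → Additive f → ∀ t → total (mapTriple f t) ≡ extend f (total t)
total-mapTriple {f} add t = begin
  sumZ (map ι (toList (mapTriple f t)))  ≡⟨ cong (sumZ ∘ map ι) (toList-mapTriple f t) ⟩
  sumZ (map ι (map f (toList t)))        ≡⟨ cong sumZ (map-∘ (toList t)) ⟨
  sumZ (map (ι ∘ f) (toList t))          ≡⟨ sumZ-extend add (toList t) ⟩
  extend f (total t)                     ∎
  where open ≡-Reasoning

!-mapTriple : ∀ f t j → mapTriple f t ! j ≡ f (t ! j)
!-mapTriple f (tri _ _ _) p₁ = refl
!-mapTriple f (tri _ _ _) p₂ = refl
!-mapTriple f (tri _ _ _) p₃ = refl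

Extension-map : ∀ {k} {u v : Vtx k} {V α j} f → Additive f → Extension u v V α j →
                Extension u v (mapTriple f V) (f α) j
Extension-map {u = u} {v} {V} {α} {j} f add ext = record
  { φ         = f ∘ φ
  ; colouring = λ w w≢u w≢v → begin
      sumZ (map (ι ∘ f ∘ φ) (endsAt w))         ≡⟨ cong sumZ (map-∘ (endsAt w)) ⟩
      sumZ (map (ι ∘ f) (map φ (endsAt w)))     ≡⟨ sumZ-extend add (map φ (endsAt w)) ⟩
      extend f (sumZ (map ι (map φ (endsAt w)))) ≡⟨ cong (extend f ∘ sumZ) (map-∘ (endsAt w)) ⟨
      extend f (sumZ (map (ι ∘ φ) (endsAt w)))  ≡⟨ cong (extend f) (colouring w w≢u w≢v) ⟩
      0Z                                        ∎
  ; U         = mapTriple f U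
  ; φ-at-u    = trans (map-∘ {g = f} {φ} (incidentEdges u)) (trans (cong (map f) φ-at-u) (sym (toList-mapTriple f U)))
  ; φ-at-v    = trans (map-∘ {g = f} {φ} (incidentEdges v)) (trans (cong (map f) φ-at-v) (sym (toList-mapTriple f V)))
  ; U-at-j    = trans (!-mapTriple f U j) (cong f U-at-j)
  ; U-total   = trans (total-mapTriple add U) (trans (cong (extend f) U-total) (sym (total-mapTriple add V)))
  }
  where
  open Extension ext
  open ≡-Reasoning

recolour : 𝕂 → 𝕂 → 𝕂 → 𝕂
recolour α t κ₁ = α
recolour α t κ₂ = α +ᶜ t
recolour α t κ₃ = t

normalise : 𝕂 → 𝕂 → 𝕂 → 𝕂
normalise α t x = if ⌊ x ≟ᶜ α ⌋ then κ₁ else if ⌊ x ≟ᶜ t ⌋ then κ₃ else κ₂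

recolour-additive : ∀ {α t} → α ≢ t → Additive (recolour α t)
recolour-additive {α} {t} α≢t x z = toWitness (by-exhaustion⇒
  (λ (α , t , x , z) → not ⌊ α ≟ᶜ t ⌋)
  (λ (α , t , x , z) → ⌊ extend (recolour α t) (ι x ⊕ z) ≟ᶻ ι (recolour α t x) ⊕ extend (recolour α t) z ⌋)
  tt (α , t , x , z) (fromWitnessFalse α≢t))

recolour-normalise : ∀ {α t} → α ≢ t → ∀ x → recolour α t (normalise α t x) ≡ x
recolour-normalise {α} {t} α≢t x = toWitness (by-exhaustion⇒
  (λ (α , t , x) → not ⌊ α ≟ᶜ t ⌋)
  (λ (α , t , x) → ⌊ recolour α t (normalise α t x) ≟ᶜ x ⌋)
  tt (α , t , x) (fromWitnessFalse α≢t))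

normalise-normalised : ∀ {α t} → α ≢ t → ∀ V → total V ≡ ι t → T (normalised (mapTriple (normalise α t) V) κ₁)
normalise-normalised {α} {t} α≢t V total≡t = by-exhaustion⇒
  (λ (α , t , V) → not ⌊ α ≟ᶜ t ⌋ ∧ ⌊ total V ≟ᶻ ι t ⌋)
  (λ (α , t , V) → normalised (mapTriple (normalise α t) V) κ₁)
  tt (α , t , V)
  (Equivalence.from (T-∧ {not ⌊ α ≟ᶜ t ⌋}) (fromWitnessFalse α≢t , fromWitness {a? = total V ≟ᶻ ι t} total≡t))

infix 4 _≟ᵖ_
_≟ᵖ_ : DecidableEquality Pos
p₁ ≟ᵖ p₁ = yes refl
p₂ ≟ᵖ p₂ = yes refl
p₃ ≟ᵖ p₃ = yes refl
p₁ ≟ᵖ p₂ = no λ ()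
p₁ ≟ᵖ p₃ = no λ ()
p₂ ≟ᵖ p₁ = no λ ()
p₂ ≟ᵖ p₃ = no λ ()
p₃ ≟ᵖ p₁ = no λ ()
p₃ ≟ᵖ p₂ = no λ ()

list₃ : {A : Set} → (Pos → A) → List A
list₃ y = y p₁ ∷ y p₂ ∷ y p₃ ∷ []

Distinct₃ : {A : Set} → (Pos → A) → Set
Distinct₃ y = y p₁ ≢ y p₂ × y p₁ ≢ y p₃ × y p₂ ≢ y p₃

Distinct₃-injective : ∀ {A : Set} {y : Pos → A} → Distinct₃ y → ∀ i j → y i ≡ y j → i ≡ j
Distinct₃-injective _                p₁ p₁ _  = refl
Distinct₃-injective _                p₂ p₂ _  = refl
Distinct₃-injective _                p₃ p₃ _  = refl
Distinct₃-injective (≢₁₂ , _ , _)    p₁ p₂ eq = ⊥-elim (≢₁₂ eq)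
Distinct₃-injective (≢₁₂ , _ , _)    p₂ p₁ eq = ⊥-elim (≢₁₂ (sym eq))
Distinct₃-injective (_ , ≢₁₃ , _)    p₁ p₃ eq = ⊥-elim (≢₁₃ eq)
Distinct₃-injective (_ , ≢₁₃ , _)    p₃ p₁ eq = ⊥-elim (≢₁₃ (sym eq))
Distinct₃-injective (_ , _ , ≢₂₃)    p₂ p₃ eq = ⊥-elim (≢₂₃ eq)
Distinct₃-injective (_ , _ , ≢₂₃)    p₃ p₂ eq = ⊥-elim (≢₂₃ (sym eq))

edgeSlot : ∀ {k} → Edge k → Fin k
edgeSlot (ab i) = i
edgeSlot (ac i) = i
edgeSlot (ad i) = i
edgeSlot (bb i) = i
edgeSlot (cc i) = i
edgeSlot (dd i) = i

-- Needs k ≥ 2: in J_1 the edge bb 0 would be a loop.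
incident-distinct : ∀ {n} (w : Vtx (suc (suc n))) → Distinct₃ (incident w)
incident-distinct (a j) = (λ ()) , (λ ()) , (λ ())
incident-distinct (b j) = (λ ()) , (λ ()) , λ eq → prev≢ j (sym (cong edgeSlot eq))
incident-distinct (c j) with isLast (prev j)
... | true  = (λ ()) , (λ ()) , (λ ())
... | false = (λ ()) , (λ ()) , λ eq → prev≢ j (sym (cong edgeSlot eq))
incident-distinct (d j) with isLast (prev j)
... | true  = (λ ()) , (λ ()) , (λ ())
... | false = (λ ()) , (λ ()) , λ eq → prev≢ j (sym (cong edgeSlot eq))

position : ∀ {A : Set} (y : Pos → A) {x} → x ∈ list₃ y → ∃[ j ] x ≡ y j
position y (here eq)                 = p₁ , eq
position y (there (here eq))         = p₂ , eq
position y (there (there (here eq))) = p₃ , eq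

∈-list₃ : ∀ {A : Set} (y : Pos → A) j → y j ∈ list₃ y
∈-list₃ y p₁ = here refl
∈-list₃ y p₂ = there (here refl)
∈-list₃ y p₃ = there (there (here refl))

colour-at : ∀ {A : Set} (y : Pos → A) (φ : A → 𝕂) {t} → map φ (list₃ y) ≡ toList t → ∀ j → φ (y j) ≡ t ! j
colour-at y φ {tri _ _ _} refl p₁ = refl
colour-at y φ {tri _ _ _} refl p₂ = refl
colour-at y φ {tri _ _ _} refl p₃ = refl

arrange : Pos → Pos → 𝕂 → 𝕂 → 𝕂 → Triple
arrange i₁ i₂ γ δ ε = tri (colour p₁) (colour p₂) (colour p₃)
  where
  colour : Pos → 𝕂
  colour m = if ⌊ m ≟ᵖ i₁ ⌋ then γ else if ⌊ m ≟ᵖ i₂ ⌋ then δ else ε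

Covers : Pos → Pos → Pos → Pos → Set
Covers i₁ i₂ i₃ m = m ≡ i₁ ⊎ m ≡ i₂ ⊎ m ≡ i₃

Arranged : Pos → Pos → Pos → 𝕂 → 𝕂 → 𝕂 → Set
Arranged i₁ i₂ i₃ γ δ ε =
  V ! i₁ ≡ γ × V ! i₂ ≡ δ × V ! i₃ ≡ ε × total V ≡ ι γ ⊕ ι δ ⊕ ι ε
  where V = arrange i₁ i₂ γ δ ε

arrange-spec : ∀ i₁ i₂ i₃ γ δ ε → (∀ m → Covers i₁ i₂ i₃ m) → Arranged i₁ i₂ i₃ γ δ ε
arrange-spec i₁ i₂ i₃ γ δ ε cover = toWitness (by-exhaustion⇒
  (λ (i₁ , i₂ , i₃ , _) → ⌊ covers? i₁ i₂ i₃ p₁ ×-dec covers? i₁ i₂ i₃ p₂ ×-dec covers? i₁ i₂ i₃ p₃ ⌋)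
  (λ (i₁ , i₂ , i₃ , γ , δ , ε) → ⌊ arranged? i₁ i₂ i₃ γ δ ε ⌋)
  tt (i₁ , i₂ , i₃ , γ , δ , ε) (fromWitness (cover p₁ , cover p₂ , cover p₃)))
  where
  covers? : ∀ i₁ i₂ i₃ m → Dec (Covers i₁ i₂ i₃ m)
  covers? i₁ i₂ i₃ m = m ≟ᵖ i₁ ⊎-dec m ≟ᵖ i₂ ⊎-dec m ≟ᵖ i₃
  arranged? : ∀ i₁ i₂ i₃ γ δ ε → Dec (Arranged i₁ i₂ i₃ γ δ ε)
  arranged? i₁ i₂ i₃ γ δ ε = let V = arrange i₁ i₂ γ δ ε in
    V ! i₁ ≟ᶜ γ ×-dec V ! i₂ ≟ᶜ δ ×-dec V ! i₃ ≟ᶜ ε ×-dec total V ≟ᶻ ι γ ⊕ ι δ ⊕ ι ε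

-- V is chosen before φ: the order of the semiedges f₁, f₂, f₃ is absorbed into V.
arrangement : ∀ {A : Set} {y : Pos → A} {f₁ f₂ f₃} → Distinct₃ y → (f₁ ∷ f₂ ∷ f₃ ∷ []) ↭ list₃ y →
              ∀ γ δ ε → ∃[ V ] total V ≡ ι γ ⊕ ι δ ⊕ ι ε
                             × (∀ φ → map φ (list₃ y) ≡ toList V → φ f₁ ≡ γ × φ f₂ ≡ δ × φ f₃ ≡ ε)
arrangement {y = y} distinct fs↭ys γ δ ε =
  arrange i₁ i₂ γ δ ε , total≡ , λ φ φ≡ →
    trans (cong φ f₁≡) (trans (colour-at y φ φ≡ i₁) at₁) ,
    trans (cong φ f₂≡) (trans (colour-at y φ φ≡ i₂) at₂) ,
    trans (cong φ f₃≡) (trans (colour-at y φ φ≡ i₃) at₃)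
  where
  i₁,f₁≡ = position y (∈-resp-↭ fs↭ys (here refl))
  i₂,f₂≡ = position y (∈-resp-↭ fs↭ys (there (here refl)))
  i₃,f₃≡ = position y (∈-resp-↭ fs↭ys (there (there (here refl))))
  i₁ = proj₁ i₁,f₁≡
  i₂ = proj₁ i₂,f₂≡
  i₃ = proj₁ i₃,f₃≡
  f₁≡ = proj₂ i₁,f₁≡
  f₂≡ = proj₂ i₂,f₂≡
  f₃≡ = proj₂ i₃,f₃≡
  cover : ∀ m → Covers i₁ i₂ i₃ m
  cover m with ∈-resp-↭ (↭.↭-sym fs↭ys) (∈-list₃ y m)
  ... | here eq                 = inj₁ (Distinct₃-injective distinct m i₁ (trans eq f₁≡))
  ... | there (here eq)         = inj₂ (inj₁ (Distinct₃-injective distinct m i₂ (trans eq f₂≡)))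
  ... | there (there (here eq)) = inj₂ (inj₂ (Distinct₃-injective distinct m i₃ (trans eq f₃≡)))
  spec = arrange-spec i₁ i₂ i₃ γ δ ε cover
  at₁ = proj₁ spec
  at₂ = proj₁ (proj₂ spec)
  at₃ = proj₁ (proj₂ (proj₂ spec))
  total≡ = proj₂ (proj₂ (proj₂ spec))

gapOf-odd-ring : ∀ m → 3 ≤ m → Odd (suc (suc m)) → gapOf m ≡ gₒ
gapOf-odd-ring m 3≤m (zero , ())
gapOf-odd-ring m 3≤m (suc zero , eq) =
  contradiction (subst (3 ≤_) (suc-injective (suc-injective eq)) 3≤m) λ { (s≤s ()) }
gapOf-odd-ring m _   (suc (suc h) , eq) = subst (λ m → gapOf m ≡ gₒ) (sym m≡) (gapOf-odd h)
  where
  m≡ : m ≡ suc (suc h + suc h)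
  m≡ = trans (suc-injective (suc-injective eq)) (cong suc (+-suc h (suc h)))

Placed-size : ∀ {n} {w₁ w₂ : Vtx (suc (suc n))} {p q r} → Placed w₁ w₂ p q r → q + (r + p) ≡ n
Placed-size {n} {p = p} {q} {r} placed = suc-injective (suc-injective (begin
  suc (suc (q + (r + p)))  ≡⟨ cong (λ x → suc (suc x)) (trans (sym (+-assoc q r p)) (+-comm (q + r) p)) ⟩
  suc (suc (p + (q + r)))  ≡⟨ cong suc (+-suc p (q + r)) ⟨
  suc (p + suc (q + r))    ≡⟨ +-suc p (suc (q + r)) ⟨
  p + suc (suc (q + r))    ≡⟨ cong (λ x → p + suc x) (+-suc q r) ⟨
  p + suc (q + suc r)      ≡⟨ Placed.size placed ⟩
  suc (suc n)              ∎))
  where open ≡-Reasoning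

placement : ∀ {n} (w₁ w₂ : Vtx (suc n)) → toℕ (slot w₁) < toℕ (slot w₂) → ∃[ p ] ∃[ q ] ∃[ r ] Placed w₁ w₂ p q r
placement {n} w₁ w₂ lt = p , q , r , record { at₁ = refl ; at₂ = at₂ ; size = size }
  where
  p = toℕ (slot w₁)
  q = proj₁ (m≤n⇒∃[o]m+o≡n lt)
  r = proj₁ (m≤n⇒∃[o]m+o≡n (toℕ<n (slot w₂)))
  at₂ : toℕ (slot w₂) ≡ p + suc q
  at₂ = trans (sym (proj₂ (m≤n⇒∃[o]m+o≡n lt))) (sym (+-suc p q))
  size : p + suc (q + suc r) ≡ suc n
  size = begin
    p + suc (q + suc r)      ≡⟨ +-assoc p (suc q) (suc r) ⟨
    p + suc q + suc r        ≡⟨ cong (_+ suc r) at₂ ⟨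
    toℕ (slot w₂) + suc r    ≡⟨ +-suc (toℕ (slot w₂)) r ⟩
    suc (toℕ (slot w₂) + r)  ≡⟨ proj₂ (m≤n⇒∃[o]m+o≡n (toℕ<n (slot w₂))) ⟩
    suc n                    ∎
    where open ≡-Reasoning

Placed-admissible : ∀ {n} {w₁ w₂ : Vtx (suc (suc n))} {p q r} → 3 ≤ n → Odd (suc (suc n)) →
                    Placed w₁ w₂ p q r → T (oddGap (gapOf q ⊞ gapOf (r + p)))
Placed-admissible {n} {p = p} {q} {r} 3≤n odd placed = subst (T ∘ oddGap) (begin
  gₒ                         ≡⟨ gapOf-odd-ring n 3≤n odd ⟨
  gapOf n                    ≡⟨ cong gapOf (Placed-size placed) ⟨
  gapOf (q + (r + p))        ≡⟨ gapOf-+ q (r + p) ⟩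
  gapOf q ⊞ gapOf (r + p)    ∎) tt
  where open ≡-Reasoning

extension-normalised : ∀ {n} {u v : Vtx (suc (suc n))} → 3 ≤ n → Odd (suc (suc n)) → Dist≥3 u v →
                       ∀ {V α} j → T (normalised V α) → Extension u v V α j
extension-normalised {u = u} {v} 3≤n odd far {V} {α} j norm with <-cmp (toℕ (slot u)) (toℕ (slot v))
... | tri≈ _ same _ = contradiction far (close-at (subst (λ i → ¬ Dist≥3 _ (vertex (kind v) i))
                                                         (toℕ-injective same) (close-same (slot u) (kind u) (kind v))))
... | tri< u<v _ _ =
  let p , q , r , placed = placement u v u<v
      ξ = u-first , gapOf q , gapOf (r + p) , kind u , kind v , V , α , j
      solution xᵤ sᵤ yᵤ xᵥ sᵥ yᵥ , links , okᵤ , okᵥ , at-v , at-j , total≡ =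
        solution-exists ξ (Equivalence.from T-∧ (Placed-admissible 3≤n odd placed ,
                                                 Equivalence.from T-∧ (separated placed far , norm)))
      link₁₂ , link₂₁ = Equivalence.to T-∧ links
      φ , colouring , φ-at-u , φ-at-v = colouring-from-slices placed okᵤ okᵥ link₁₂ link₂₁
  in record { φ = φ ; colouring = colouring ; U = star (kind u) xᵤ sᵤ yᵤ ; φ-at-u = φ-at-u
            ; φ-at-v = trans φ-at-v (cong toList at-v) ; U-at-j = at-j ; U-total = total≡ }
... | tri> _ _ v<u =
  let p , q , r , placed = placement v u v<u
      ξ = v-first , gapOf q , gapOf (r + p) , kind u , kind v , V , α , j
      solution xᵤ sᵤ yᵤ xᵥ sᵥ yᵥ , links , okᵤ , okᵥ , at-v , at-j , total≡ =
        solution-exists ξ (Equivalence.from T-∧ (Placed-admissible 3≤n odd placed ,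
                                                 Equivalence.from T-∧ (separated placed (Dist≥3-sym far) , norm)))
      link₁₂ , link₂₁ = Equivalence.to T-∧ links
      φ , colouring , φ-at-v , φ-at-u = colouring-from-slices placed okᵥ okᵤ link₁₂ link₂₁
  in record { φ = φ ; colouring = λ w w≢u w≢v → colouring w w≢v w≢u ; U = star (kind u) xᵤ sᵤ yᵤ
            ; φ-at-u = φ-at-u ; φ-at-v = trans φ-at-v (cong toList at-v) ; U-at-j = at-j ; U-total = total≡ }

colourOf : ∀ z → z ≢ 0Z → ∃[ t ] ι t ≡ z
colourOf (false , false) z≢0 = contradiction refl z≢0
colourOf (false , true)  _   = κ₁ , refl
colourOf (true  , false) _   = κ₂ , refl
colourOf (true  , true)  _   = κ₃ , refl

mapTriple-inverse : ∀ {f g} → (∀ x → f (g x) ≡ x) → ∀ t → mapTriple f (mapTriple g t) ≡ t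
mapTriple-inverse inv (tri x y z) = cong₂ (λ x (y , z) → tri x y z) (inv x) (cong₂ _,_ (inv y) (inv z))

-- Permuting the colours reduces to α = κ₁ and total V = κ₃.
extension : ∀ {n} {u v : Vtx (suc (suc n))} → 3 ≤ n → Odd (suc (suc n)) → Dist≥3 u v →
            ∀ V α j → total V ≢ 0Z → ι α ≢ total V → Extension u v V α j
extension {u = u} {v} 3≤n odd far V α j V≢0 α≢V =
  subst (λ W → Extension u v W α j) (mapTriple-inverse (recolour-normalise α≢t) V)
    (Extension-map (recolour α t) (recolour-additive α≢t)
      (extension-normalised 3≤n odd far {mapTriple (normalise α t) V} {κ₁} j
        (normalise-normalised α≢t V (sym t≡))))
  where
  t  = proj₁ (colourOf (total V) V≢0)
  t≡ = proj₂ (colourOf (total V) V≢0)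
  α≢t : α ≢ t
  α≢t α≡t = α≢V (trans (cong ι α≡t) t≡)

lemma6 : (k : ℕ) → 5 ≤ k → Odd k →
           (u v : Vtx k) → Dist≥3 u v →
           (e₁ e₂ e₃ f₁ f₂ f₃ : Edge k) →
           endsAt u ↭ (e₁ ∷ e₂ ∷ e₃ ∷ []) →
           endsAt v ↭ (f₁ ∷ f₂ ∷ f₃ ∷ []) →
           (α β γ δ ε : 𝕂) →
           ι α ⊕ ι β ≡ ι γ ⊕ ι δ ⊕ ι ε →
           ι α ⊕ ι β ≢ 0Z →
           ∃[ β₂ ] ∃[ β₃ ] (ι β₂ ⊕ ι β₃ ≡ ι β
             × InCol u v e₁ e₂ e₃ f₁ f₂ f₃ α β₂ β₃ γ δ ε)
lemma6 (suc (suc n)) (s≤s (s≤s 3≤n)) odd u v far e₁ e₂ e₃ f₁ f₂ f₃ ends-u ends-v α β γ δ ε sum≡ sum≢0 =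
  φ e₂ , φ e₃ , β-split , φ , colouring , φe₁≡α , refl , refl , proj₂ (proj₂ arranged) φ φ-at-v
  where
  es↭ = ↭-trans (↭.↭-sym ends-u) (endsAt↭incidentEdges u)
  fs↭ = ↭-trans (↭.↭-sym ends-v) (endsAt↭incidentEdges v)
  arranged = arrangement {y = incident v} (incident-distinct v) fs↭ γ δ ε
  V = proj₁ arranged
  V≡ : total V ≡ ι α ⊕ ι β
  V≡ = trans (proj₁ (proj₂ arranged)) (sym sum≡)
  j,e₁≡ = position (incident u) (∈-resp-↭ es↭ (here refl))
  open Extension (extension 3≤n odd far V α (proj₁ j,e₁≡) (sum≢0 ∘ trans (sym V≡))
                            (ι≢ι⊕ι α β ∘ flip trans V≡))
  φe₁≡α : φ e₁ ≡ α
  φe₁≡α = trans (cong φ (proj₂ j,e₁≡)) (trans (colour-at (incident u) φ φ-at-u (proj₁ j,e₁≡)) U-at-j)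
  β-split : ι (φ e₂) ⊕ ι (φ e₃) ≡ ι β
  β-split = ⊕-cancelˡ (ι α) (begin
    ι α ⊕ (ι (φ e₂) ⊕ ι (φ e₃))              ≡⟨ cong₂ (λ x y → ι x ⊕ (ι (φ e₂) ⊕ y)) φe₁≡α (⊕-identityʳ _) ⟨
    sumZ (map (ι ∘ φ) (e₁ ∷ e₂ ∷ e₃ ∷ []))  ≡⟨ sumZ-colours φ es↭ φ-at-u ⟩
    total U                                 ≡⟨ trans U-total V≡ ⟩
    ι α ⊕ ι β                               ∎)
    where open ≡-Reasoning
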